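{- Let $i,j,k$ be nonnegative integers. The integrality ratio of the instance $I^3_{i,j,k}$ is at least $1+\frac{1}{3+2\left(\frac{1}{i+1}+\frac{1}{j+1}+\frac{1}{k+1}\right)}$.
   Context: $I^3_{i,j,k}$ is the \textsc{Multidimensional Rectilinear TSP} instance with the $i+j+k+6$ points $X_s=\left(0,0,\frac{s}{i+1}\right)$ for $0\le s\le i+1$, $Y_s=\left(\frac{1}{i+1}+\frac{1}{j+1},0,\frac{s}{j+1}\right)$ for $0\le s\le j+1$, and $Z_s=\left(\frac{1}{i+1},\frac{1}{k+1},\frac{s}{k+1}\right)$ for $0\le s\le k+1$, with distances $\|u-v\|_1$. The integrality ratio of an instance $I$ is $OPT(I)/OPT_{LP}(I)$, where $OPT$ is the minimum length of a Hamiltonian cycle and $OPT_{LP}$ the optimal value of the subtour LP: minimize $\sum_e c(e)x_e$ subject to $\sum_{e\in\delta(v)}x_e=2$ for all $v$, $\sum_{e\in\delta(X)}x_e\ge2$ for all $\emptyset\ne X\subsetneq V$, $0\le x_e\le 1$. -}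

module Defs where

open import Data.Nat as ℕ using (ℕ; suc)
open import Data.Integer using (+_)
open import Data.Rational using (ℚ; _/_; _+_; _*_; _-_; ∣_∣; _≤_; 0ℚ; 1ℚ)
open import Data.Fin using (Fin; toℕ)
open import Data.Fin.Properties renaming (_≟_ to _≟ᶠ_)
open import Data.Sum using (_⊎_; inj₁; inj₂)
open import Data.Sum.Properties using (≡-dec)
open import Data.Product using (_×_; _,_; ∃)
open import Data.Bool using (Bool; true; false)
open import Data.List using (List; []; _∷_; _++_; map; foldr; filter)
open import Data.List.Relation.Unary.Unique.Propositional using (Unique)
open import Data.List.Membership.Propositional using (_∈_)
open import Relation.Binary.PropositionalEquality using (_≡_; _≢_)
open import Relation.Binary.Definitions using (DecidableEquality)
open import Relation.Nullary using (yes; no)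

-- Vertex set of I^3_{i,j,k}: X_0..X_{i+1}, Y_0..Y_{j+1}, Z_0..Z_{k+1}
-- (i+j+k+6 vertices in total).
V : ℕ → ℕ → ℕ → Set
V i j k = Fin (suc (suc i)) ⊎ (Fin (suc (suc j)) ⊎ Fin (suc (suc k)))

_≟V_ : ∀ {i j k} → DecidableEquality (V i j k)
_≟V_ = ≡-dec _≟ᶠ_ (≡-dec _≟ᶠ_ _≟ᶠ_)

Point : Set
Point = ℚ × ℚ × ℚ

frac : ℕ → ℕ → ℚ
frac n m = (+ n) / suc m

pos : (i j k : ℕ) → V i j k → Point
pos i j k (inj₁ s)        = 0ℚ , 0ℚ , frac (toℕ s) i
pos i j k (inj₂ (inj₁ s)) = (frac 1 i + frac 1 j) , 0ℚ , frac (toℕ s) j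
pos i j k (inj₂ (inj₂ s)) = frac 1 i , frac 1 k , frac (toℕ s) k

dist₁ : Point → Point → ℚ
dist₁ (a , b , c) (a' , b' , c') = ∣ a - a' ∣ + ∣ b - b' ∣ + ∣ c - c' ∣

cost : (i j k : ℕ) → V i j k → V i j k → ℚ
cost i j k u v = dist₁ (pos i j k u) (pos i j k v)

allFinL : (n : ℕ) → List (Fin n)
allFinL n = Data.List.tabulate (λ x → x)

allV : (i j k : ℕ) → List (V i j k)
allV i j k = map inj₁ (allFinL _) ++ (map (λ s → inj₂ (inj₁ s)) (allFinL _) ++ map (λ s → inj₂ (inj₂ s)) (allFinL _))

sumℚ : {A : Set} → (A → ℚ) → List A → ℚ
sumℚ f = foldr (λ a r → f a + r) 0ℚ

-- Hamiltonian cycles: a tour is a list visiting every vertex exactly once;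
-- the cycle closes from the last vertex back to the first.

record Tour (i j k : ℕ) : Set where
  field
    order    : List (V i j k)
    unique   : Unique order
    complete : ∀ v → v ∈ order

pathLength : ∀ {i j k} → V i j k → List (V i j k) → ℚ
pathLength {i} {j} {k} u []      = 0ℚ
pathLength {i} {j} {k} u (v ∷ l) = cost i j k u v + pathLength v l

closedLength : ∀ {i j k} → List (V i j k) → ℚ
closedLength []      = 0ℚ
closedLength (v ∷ l) = pathLength v (l ++ (v ∷ []))

tourLength : ∀ {i j k} → Tour i j k → ℚ
tourLength t = closedLength (Tour.order t)

-- Subtour LP.  A point x assigns to each (unordered) edge {u,v}, u ≠ v,
-- a value; it is represented as a symmetric function V → V → ℚ whose
-- diagonal is ignored.

sumOthers : ∀ {i j k} → V i j k → (V i j k → ℚ) → ℚ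
sumOthers {i} {j} {k} u f = sumℚ (λ v → g v (u ≟V v)) (allV i j k)
  where
  g : ∀ v → Relation.Nullary.Dec (u ≡ v) → ℚ
  g v (yes _) = 0ℚ
  g v (no _)  = f v

-- sum over edges of c(e) x_e : each unordered edge counted twice, hence * 1/2
lpCost : ∀ {i j k} → (V i j k → V i j k → ℚ) → ℚ
lpCost {i} {j} {k} x =
  ((+ 1) / 2) * sumℚ (λ u → sumOthers u (λ v → cost i j k u v * x u v)) (allV i j k)

cutValue : ∀ {i j k} → (V i j k → Bool) → (V i j k → V i j k → ℚ) → ℚ
cutValue {i} {j} {k} S x =
  sumℚ (λ u → sumℚ (λ w → x u w) (filter (λ w → Data.Bool._≟_ (S w) false) (allV i j k)))
       (filter (λ u → Data.Bool._≟_ (S u) true) (allV i j k))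

two : ℚ
two = (+ 2) / 1

record SubtourFeasible (i j k : ℕ) (x : V i j k → V i j k → ℚ) : Set where
  field
    symmetric : ∀ u v → x u v ≡ x v u
    lower     : ∀ u v → u ≢ v → 0ℚ ≤ x u v
    upper     : ∀ u v → u ≢ v → x u v ≤ 1ℚ
    degree    : ∀ v → sumOthers v (λ w → x v w) ≡ two
    subtour   : ∀ (S : V i j k → Bool) →
                  ∃ (λ u → S u ≡ true) → ∃ (λ w → S w ≡ false) →
                  two ≤ cutValue S x

qBound : ℕ → ℕ → ℕ → ℚ
qBound i j k = (+ 3) / 1 + two * (frac 1 i + frac 1 j + frac 1 k)

module Submission where

-- Scaling by D = (i+1)(j+1)(k+1) gives the points natural coordinates, and q = 3 + 2(1/(i+1) + 1/(j+1) + 1/(k+1))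
-- becomes 3D + 2(A + B + C) with A = D/(i+1), B = D/(j+1), C = D/(k+1).
--
-- The LP point takes value 1 on the edges of the three vertical paths and 1/2 on the edges of the bottom and the
-- top triangle.  It has degree 2 everywhere and cost q.  A cut crossing the paths c_X, c_Y, c_Z times has value
-- c_X + c_Y + c_Z plus half the number of triangle edges it separates; since c_P is odd exactly when the cut
-- separates the two ends of P, this value is at least 2 whenever the cut is proper.
--
-- A tour pays, for each edge, one unit for every horizontal level cut below height D that the edge crosses, and
-- A, B or C whenever it enters or leaves the X-, Y- or Z-path.  Each level cut is crossed an even, positive
-- number of times, hence at least four times unless some path has no edge of its own across that level.  A path
-- is entered and left at least twice, plus twice for every gap between consecutive points that none of its own
-- edges bridges; such a gap accounts for A (resp. B, C) levels.  Summing up, every tour has length at least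
-- 4D + 2(A + B + C) = (q + 1)D.

open import Defs
open import Data.Nat using (ℕ)
open import Data.Product using (Σ; _×_; _,_)

module Fractions where

  open import Data.Nat as ℕ using (suc; _+_; _*_; _≤_; _∸_; ∣_-_∣; NonZero)
  import Data.Nat.Properties as ℕP
  open import Data.Integer as ℤ using (+_)
  import Data.Integer.Properties as ℤP
  open import Data.Rational as ℚ using (ℚ; _/_; toℚᵘ; 0ℚ)
  import Data.Rational.Properties as ℚP
  open import Data.Rational.Unnormalised as ℚᵘ using (mkℚᵘ; *≡*; *≤*)
  import Data.Rational.Unnormalised.Properties as ℚᵘP
  open import Data.Rational.Solver using (module +-*-Solver)
  open import Data.Sum using (inj₁; inj₂)
  open import Relation.Binary.PropositionalEquality

  infix 8 _÷_

  _÷_ : ℕ → (d : ℕ) → .{{NonZero d}} → ℚ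
  n ÷ d = (+ n) / d

  toℚᵘ-÷ : ∀ n d → toℚᵘ (n ÷ suc d) ℚᵘ.≃ mkℚᵘ (+ n) d
  toℚᵘ-÷ n d = ℚP.toℚᵘ-fromℚᵘ (mkℚᵘ (+ n) d)

  ÷-cross-≡ : ∀ a b d e → a * suc e ≡ b * suc d → a ÷ suc d ≡ b ÷ suc e
  ÷-cross-≡ a b d e eq = ℚP.fromℚᵘ-cong {mkℚᵘ (+ a) d} {mkℚᵘ (+ b) e} (*≡* (begin
    + a ℤ.* + suc e  ≡⟨ ℤP.pos-* a (suc e) ⟨
    + (a * suc e)    ≡⟨ cong +_ eq ⟩
    + (b * suc d)    ≡⟨ ℤP.pos-* b (suc d) ⟩
    + b ℤ.* + suc d  ∎))
    where open ≡-Reasoning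

  ÷-cross-≤ : ∀ a b d e → a * suc e ≤ b * suc d → a ÷ suc d ℚ.≤ b ÷ suc e
  ÷-cross-≤ a b d e le = ℚP.toℚᵘ-cancel-≤
    (ℚᵘP.≤-respʳ-≃ (ℚᵘP.≃-sym (toℚᵘ-÷ b e)) (ℚᵘP.≤-respˡ-≃ (ℚᵘP.≃-sym (toℚᵘ-÷ a d))
      (*≤* (subst₂ ℤ._≤_ (ℤP.pos-* a (suc e)) (ℤP.pos-* b (suc d)) (ℤ.+≤+ le)))))

  ÷-+ : ∀ a b d e → a ÷ suc d ℚ.+ b ÷ suc e ≡ (a * suc e + b * suc d) ÷ (suc d * suc e)
  ÷-+ a b d e = ℚP.toℚᵘ-injective (begin
    toℚᵘ (a ÷ suc d ℚ.+ b ÷ suc e)                    ≈⟨ ℚP.toℚᵘ-homo-+ (a ÷ suc d) (b ÷ suc e) ⟩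
    toℚᵘ (a ÷ suc d) ℚᵘ.+ toℚᵘ (b ÷ suc e)            ≈⟨ ℚᵘP.+-cong (toℚᵘ-÷ a d) (toℚᵘ-÷ b e) ⟩
    mkℚᵘ (+ a) d ℚᵘ.+ mkℚᵘ (+ b) e                   ≈⟨ *≡* (cong (ℤ._* + suc (e + d * suc e)) numerator) ⟩
    mkℚᵘ (+ (a * suc e + b * suc d)) (e + d * suc e)  ≈⟨ toℚᵘ-÷ _ _ ⟨
    toℚᵘ ((a * suc e + b * suc d) ÷ (suc d * suc e))  ∎)
    where
    open import Relation.Binary.Reasoning.Setoid ℚᵘP.≃-setoid
    numerator : + a ℤ.* + suc e ℤ.+ + b ℤ.* + suc d ≡ + (a * suc e + b * suc d)
    numerator = sym (trans (ℤP.pos-+ (a * suc e) (b * suc d))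
                           (cong₂ ℤ._+_ (ℤP.pos-* a (suc e)) (ℤP.pos-* b (suc d))))

  ÷-* : ∀ a b d e → a ÷ suc d ℚ.* b ÷ suc e ≡ (a * b) ÷ (suc d * suc e)
  ÷-* a b d e = ℚP.toℚᵘ-injective (begin
    toℚᵘ (a ÷ suc d ℚ.* b ÷ suc e)          ≈⟨ ℚP.toℚᵘ-homo-* (a ÷ suc d) (b ÷ suc e) ⟩
    toℚᵘ (a ÷ suc d) ℚᵘ.* toℚᵘ (b ÷ suc e)  ≈⟨ ℚᵘP.*-cong (toℚᵘ-÷ a d) (toℚᵘ-÷ b e) ⟩
    mkℚᵘ (+ a) d ℚᵘ.* mkℚᵘ (+ b) e         ≈⟨ *≡* (cong (ℤ._* + suc (e + d * suc e)) (sym (ℤP.pos-* a b))) ⟩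
    mkℚᵘ (+ (a * b)) (e + d * suc e)        ≈⟨ toℚᵘ-÷ _ _ ⟨
    toℚᵘ ((a * b) ÷ (suc d * suc e))        ∎)
    where open import Relation.Binary.Reasoning.Setoid ℚᵘP.≃-setoid

  ÷-+-same : ∀ a b d → a ÷ suc d ℚ.+ b ÷ suc d ≡ (a + b) ÷ suc d
  ÷-+-same a b d = trans (÷-+ a b d d) (÷-cross-≡ (a * suc d + b * suc d) (a + b) (d + d * suc d) d (begin
    (a * suc d + b * suc d) * suc d  ≡⟨ cong (_* suc d) (ℕP.*-distribʳ-+ (suc d) a b) ⟨
    (a + b) * suc d * suc d          ≡⟨ ℕP.*-assoc (a + b) (suc d) (suc d) ⟩
    (a + b) * (suc d * suc d)        ∎))
    where open ≡-Reasoning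

  0÷ : ∀ d → 0 ÷ suc d ≡ 0ℚ
  0÷ d = ÷-cross-≡ 0 0 d 0 refl

  ÷-monoˡ-≤ : ∀ {a b} d → a ≤ b → a ÷ suc d ℚ.≤ b ÷ suc d
  ÷-monoˡ-≤ {a} {b} d le = ÷-cross-≤ a b d d (ℕP.*-monoˡ-≤ (suc d) le)

  ÷-nonNeg : ∀ a d → 0ℚ ℚ.≤ a ÷ suc d
  ÷-nonNeg a d = subst (ℚ._≤ a ÷ suc d) (0÷ d) (÷-monoˡ-≤ {0} {a} d ℕ.z≤n)

  private
    open +-*-Solver
    x+y-x≡y : ∀ x y → (x ℚ.+ y) ℚ.- x ≡ y
    x+y-x≡y = solve 2 (λ x y → (x :+ y) :- x := y) refl
    x-y≡-[y-x] : ∀ x y → x ℚ.- y ≡ ℚ.- (y ℚ.- x)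
    x-y≡-[y-x] = solve 2 (λ x y → x :- y := :- (y :- x)) refl

  ∣÷-÷∣-≥ : ∀ {m n} d → n ≤ m → ℚ.∣ m ÷ suc d ℚ.- n ÷ suc d ∣ ≡ ∣ m - n ∣ ÷ suc d
  ∣÷-÷∣-≥ {m} {n} d n≤m = begin
    ℚ.∣ m ÷ suc d ℚ.- n ÷ suc d ∣                        ≡⟨ cong (λ k → ℚ.∣ k ÷ suc d ℚ.- n ÷ suc d ∣) (ℕP.m+[n∸m]≡n n≤m) ⟨
    ℚ.∣ (n + (m ∸ n)) ÷ suc d ℚ.- n ÷ suc d ∣            ≡⟨ cong (λ q → ℚ.∣ q ℚ.- n ÷ suc d ∣) (÷-+-same n (m ∸ n) d) ⟨
    ℚ.∣ (n ÷ suc d ℚ.+ (m ∸ n) ÷ suc d) ℚ.- n ÷ suc d ∣  ≡⟨ cong ℚ.∣_∣ (x+y-x≡y (n ÷ suc d) ((m ∸ n) ÷ suc d)) ⟩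
    ℚ.∣ (m ∸ n) ÷ suc d ∣                                ≡⟨ ℚP.0≤p⇒∣p∣≡p (÷-nonNeg (m ∸ n) d) ⟩
    (m ∸ n) ÷ suc d                                       ≡⟨ cong (_÷ suc d) (ℕP.m≤n⇒∣n-m∣≡n∸m n≤m) ⟨
    ∣ m - n ∣ ÷ suc d                                     ∎
    where open ≡-Reasoning

  ∣÷-÷∣ : ∀ a b d → ℚ.∣ a ÷ suc d ℚ.- b ÷ suc d ∣ ≡ ∣ a - b ∣ ÷ suc d
  ∣÷-÷∣ a b d with ℕP.≤-total b a
  ... | inj₁ b≤a = ∣÷-÷∣-≥ d b≤a
  ... | inj₂ a≤b = begin
    ℚ.∣ a ÷ suc d ℚ.- b ÷ suc d ∣       ≡⟨ cong ℚ.∣_∣ (x-y≡-[y-x] (a ÷ suc d) (b ÷ suc d)) ⟩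
    ℚ.∣ ℚ.- (b ÷ suc d ℚ.- a ÷ suc d) ∣ ≡⟨ ℚP.∣-p∣≡∣p∣ _ ⟩
    ℚ.∣ b ÷ suc d ℚ.- a ÷ suc d ∣       ≡⟨ ∣÷-÷∣-≥ d a≤b ⟩
    ∣ b - a ∣ ÷ suc d                   ≡⟨ cong (_÷ suc d) (ℕP.∣-∣-comm b a) ⟩
    ∣ a - b ∣ ÷ suc d                   ∎
    where open ≡-Reasoning

module Indicators where

  open import Data.Nat using (zero; suc; _+_; _≤_; _<_; _≤ᵇ_; z≤n; s≤s)
  import Data.Nat.Properties as ℕP
  open import Data.Bool using (Bool; true; false; _xor_; not; T)
  import Data.Bool.Properties as BoolP
  open import Data.Empty using (⊥-elim)
  open import Relation.Nullary using (¬_)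
  open import Relation.Binary.PropositionalEquality

  𝟙 : Bool → ℕ
  𝟙 true  = 1
  𝟙 false = 0

  𝟙≤1 : ∀ b → 𝟙 b ≤ 1
  𝟙≤1 true  = ℕP.≤-refl
  𝟙≤1 false = z≤n

  odd : ℕ → Bool
  odd zero    = false
  odd (suc n) = not (odd n)

  odd-+ : ∀ m n → odd (m + n) ≡ odd m xor odd n
  odd-+ zero    n = refl
  odd-+ (suc m) n rewrite odd-+ m n = BoolP.not-distribˡ-xor (odd m) (odd n)

  odd-𝟙 : ∀ b → odd (𝟙 b) ≡ b
  odd-𝟙 true  = refl
  odd-𝟙 false = refl

  even∧1≤⇒2≤ : ∀ {n} → odd n ≡ false → 1 ≤ n → 2 ≤ n
  even∧1≤⇒2≤ {suc (suc n)} _ _ = s≤s (s≤s z≤n)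

  even∧3≤⇒4≤ : ∀ {n} → odd n ≡ false → 3 ≤ n → 4 ≤ n
  even∧3≤⇒4≤ {suc (suc zero)} _ (s≤s (s≤s ()))
  even∧3≤⇒4≤ {suc (suc (suc (suc n)))} _ _ = s≤s (s≤s (s≤s (s≤s z≤n)))

  𝟙-xor-≢ : ∀ {x y} → x ≢ y → 𝟙 (x xor y) ≡ 1
  𝟙-xor-≢ {true}  {true}  x≢y = ⊥-elim (x≢y refl)
  𝟙-xor-≢ {true}  {false} _   = refl
  𝟙-xor-≢ {false} {true}  _   = refl
  𝟙-xor-≢ {false} {false} x≢y = ⊥-elim (x≢y refl)

  ≤⇒≤ᵇ≡true : ∀ {m n} → m ≤ n → (m ≤ᵇ n) ≡ true
  ≤⇒≤ᵇ≡true {m} {n} m≤n with m ≤ᵇ n | ℕP.≤⇒≤ᵇ m≤n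
  ... | true | _ = refl

  ≰⇒≤ᵇ≡false : ∀ {m n} → ¬ m ≤ n → (m ≤ᵇ n) ≡ false
  ≰⇒≤ᵇ≡false {m} {n} m≰n with m ≤ᵇ n in eq
  ... | true  = ⊥-elim (m≰n (ℕP.≤ᵇ⇒≤ m n (subst T (sym eq) _)))
  ... | false = refl

  <⇒≤ᵇ≡false : ∀ {m n} → n < m → (m ≤ᵇ n) ≡ false
  <⇒≤ᵇ≡false n<m = ≰⇒≤ᵇ≡false (ℕP.<⇒≱ n<m)

module Sums where

  open import Data.Nat using (zero; suc; _+_; _*_; _≤_; _<_; z≤n)
  import Data.Nat.Properties as ℕP
  open import Algebra.Properties.CommutativeSemigroup ℕP.+-commutativeSemigroup using (interchange)
  open import Relation.Binary.PropositionalEquality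

  sumBelow : ℕ → (ℕ → ℕ) → ℕ
  sumBelow zero    f = 0
  sumBelow (suc N) f = sumBelow N f + f N

  sumBelow-+ : ∀ N f g → sumBelow N (λ m → f m + g m) ≡ sumBelow N f + sumBelow N g
  sumBelow-+ zero    f g = refl
  sumBelow-+ (suc N) f g rewrite sumBelow-+ N f g = interchange (sumBelow N f) (sumBelow N g) (f N) (g N)

  sumBelow-cong : ∀ N {f g} → (∀ m → m < N → f m ≡ g m) → sumBelow N f ≡ sumBelow N g
  sumBelow-cong zero    eq = refl
  sumBelow-cong (suc N) eq = cong₂ _+_ (sumBelow-cong N (λ m m<N → eq m (ℕP.m<n⇒m<1+n m<N))) (eq N ℕP.≤-refl)

  sumBelow-mono : ∀ N {f g} → (∀ m → m < N → f m ≤ g m) → sumBelow N f ≤ sumBelow N g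
  sumBelow-mono zero    le = z≤n
  sumBelow-mono (suc N) le = ℕP.+-mono-≤ (sumBelow-mono N (λ m m<N → le m (ℕP.m<n⇒m<1+n m<N))) (le N ℕP.≤-refl)

  sumBelow-const : ∀ N c → sumBelow N (λ _ → c) ≡ N * c
  sumBelow-const zero    c = refl
  sumBelow-const (suc N) c rewrite sumBelow-const N c = ℕP.+-comm (N * c) c

  sumBelow-*ˡ : ∀ N c f → sumBelow N (λ m → c * f m) ≡ c * sumBelow N f
  sumBelow-*ˡ zero    c f = sym (ℕP.*-zeroʳ c)
  sumBelow-*ˡ (suc N) c f rewrite sumBelow-*ˡ N c f = sym (ℕP.*-distribˡ-+ c (sumBelow N f) (f N))

  sumBelow-split : ∀ N M f → sumBelow (N + M) f ≡ sumBelow N f + sumBelow M (λ r → f (N + r))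
  sumBelow-split N zero    f rewrite ℕP.+-identityʳ N = sym (ℕP.+-identityʳ _)
  sumBelow-split N (suc M) f rewrite ℕP.+-suc N M | sumBelow-split N M f = ℕP.+-assoc (sumBelow N f) _ _

  sumBelow-blocks : ∀ n A f → sumBelow (n * A) f ≡ sumBelow n (λ g → sumBelow A (λ r → f (g * A + r)))
  sumBelow-blocks zero    A f = refl
  sumBelow-blocks (suc n) A f = begin
    sumBelow (A + n * A) f                                    ≡⟨ cong (λ z → sumBelow z f) (ℕP.+-comm A (n * A)) ⟩
    sumBelow (n * A + A) f                                    ≡⟨ sumBelow-split (n * A) A f ⟩
    sumBelow (n * A) f + sumBelow A (λ r → f (n * A + r))     ≡⟨ cong (_+ sumBelow A (λ r → f (n * A + r))) (sumBelow-blocks n A f) ⟩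
    sumBelow n (λ g → sumBelow A (λ r → f (g * A + r))) + sumBelow A (λ r → f (n * A + r)) ∎
    where open ≡-Reasoning

module FinSums where

  open import Data.Nat using (zero; suc; _+_; _*_)
  import Data.Nat.Properties as ℕP
  open import Data.Fin using (Fin)
  open import Data.List using (List; []; _∷_; _++_; map; tabulate; foldr)
  open import Relation.Binary.PropositionalEquality
  open import Algebra.Properties.CommutativeSemigroup ℕP.+-commutativeSemigroup using (interchange)

  sumFin : (n : ℕ) → (Fin n → ℕ) → ℕ
  sumFin zero    f = 0
  sumFin (suc n) f = f Fin.zero + sumFin n (λ s → f (Fin.suc s))

  sumFin-cong : ∀ n {f g : Fin n → ℕ} → (∀ s → f s ≡ g s) → sumFin n f ≡ sumFin n g
  sumFin-cong zero    eq = refl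
  sumFin-cong (suc n) eq = cong₂ _+_ (eq Fin.zero) (sumFin-cong n (λ s → eq (Fin.suc s)))

  sumFin-+ : ∀ n (f g : Fin n → ℕ) → sumFin n (λ s → f s + g s) ≡ sumFin n f + sumFin n g
  sumFin-+ zero    f g = refl
  sumFin-+ (suc n) f g rewrite sumFin-+ n (λ s → f (Fin.suc s)) (λ s → g (Fin.suc s)) =
    interchange (f Fin.zero) (g Fin.zero) _ _

  sumFin-*ˡ : ∀ n c (f : Fin n → ℕ) → sumFin n (λ s → c * f s) ≡ c * sumFin n f
  sumFin-*ˡ zero    c f = sym (ℕP.*-zeroʳ c)
  sumFin-*ˡ (suc n) c f rewrite sumFin-*ˡ n c (λ s → f (Fin.suc s)) = sym (ℕP.*-distribˡ-+ c (f Fin.zero) _)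

  sumFin-zero : ∀ n {f : Fin n → ℕ} → (∀ s → f s ≡ 0) → sumFin n f ≡ 0
  sumFin-zero zero    eq = refl
  sumFin-zero (suc n) eq rewrite eq Fin.zero = sumFin-zero n (λ s → eq (Fin.suc s))

  sumFin-const : ∀ n c → sumFin n (λ _ → c) ≡ n * c
  sumFin-const zero    c = refl
  sumFin-const (suc n) c = cong (c +_) (sumFin-const n c)

  sumList : {A : Set} → (A → ℕ) → List A → ℕ
  sumList g = foldr (λ a r → g a + r) 0

  sumList-++ : ∀ {A : Set} (g : A → ℕ) l l′ → sumList g (l ++ l′) ≡ sumList g l + sumList g l′
  sumList-++ g []      l′ = refl
  sumList-++ g (x ∷ l) l′ rewrite sumList-++ g l l′ = sym (ℕP.+-assoc (g x) _ _)

  sumList-map-tabulate : ∀ {A B : Set} n (g : B → ℕ) (h : A → B) (t : Fin n → A) →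
    sumList g (map h (tabulate t)) ≡ sumFin n (λ s → g (h (t s)))
  sumList-map-tabulate zero    g h t = refl
  sumList-map-tabulate (suc n) g h t = cong (g (h (t Fin.zero)) +_) (sumList-map-tabulate n g h (λ s → t (Fin.suc s)))

  sumList-cong : ∀ {A : Set} {f g : A → ℕ} → (∀ a → f a ≡ g a) → ∀ l → sumList f l ≡ sumList g l
  sumList-cong eq []      = refl
  sumList-cong eq (x ∷ l) = cong₂ _+_ (eq x) (sumList-cong eq l)

module ClosedWalks where

  open import Data.Nat using (_+_; _*_; _≤_; z≤n; s≤s)
  import Data.Nat.Properties as ℕP
  open import Algebra.Properties.CommutativeSemigroup ℕP.+-commutativeSemigroup using (interchange)
  open import Data.Bool using (Bool; true; false; _xor_; _∧_; _∨_; _≟_)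
  import Data.Bool.Properties as BoolP
  open import Data.List using (List; []; _∷_; _++_; [_])
  open import Data.List.Membership.Propositional using (_∈_)
  open import Data.List.Relation.Unary.Any using (here; there)
  import Data.List.Membership.Propositional.Properties as ∈P
  open import Data.Empty using (⊥-elim)
  open import Relation.Nullary using (yes; no)
  open import Relation.Binary.PropositionalEquality hiding ([_])
  open import Function using (_∘_)
  open Indicators
  open Sums

  module _ {A : Set} where

    pathSum : (A → A → ℕ) → A → List A → ℕ
    pathSum f u []      = 0
    pathSum f u (w ∷ l) = f u w + pathSum f w l

    cycleSum : (A → A → ℕ) → List A → ℕ
    cycleSum f []      = 0
    cycleSum f (v ∷ l) = pathSum f v (l ++ [ v ])

    crosses : (A → Bool) → A → A → ℕ
    crosses S u w = 𝟙 (S u xor S w)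

    lastOf : A → List A → A
    lastOf u []      = u
    lastOf u (w ∷ l) = lastOf w l

    pathSum-+ : ∀ f g u l → pathSum (λ a b → f a b + g a b) u l ≡ pathSum f u l + pathSum g u l
    pathSum-+ f g u []      = refl
    pathSum-+ f g u (w ∷ l) rewrite pathSum-+ f g w l = interchange (f u w) (g u w) (pathSum f w l) (pathSum g w l)

    pathSum-cong : ∀ {f g} → (∀ a b → f a b ≡ g a b) → ∀ u l → pathSum f u l ≡ pathSum g u l
    pathSum-cong eq u []      = refl
    pathSum-cong eq u (w ∷ l) = cong₂ _+_ (eq u w) (pathSum-cong eq w l)

    pathSum-mono : ∀ {f g} → (∀ a b → f a b ≤ g a b) → ∀ u l → pathSum f u l ≤ pathSum g u l
    pathSum-mono le u []      = z≤n
    pathSum-mono le u (w ∷ l) = ℕP.+-mono-≤ (le u w) (pathSum-mono le w l)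

    pathSum-*ˡ : ∀ c f u l → pathSum (λ a b → c * f a b) u l ≡ c * pathSum f u l
    pathSum-*ˡ c f u []      = sym (ℕP.*-zeroʳ c)
    pathSum-*ˡ c f u (w ∷ l) rewrite pathSum-*ˡ c f w l = sym (ℕP.*-distribˡ-+ c (f u w) (pathSum f w l))

    pathSum-sumBelow : ∀ N (g : ℕ → A → A → ℕ) u l →
      pathSum (λ a b → sumBelow N (λ m → g m a b)) u l ≡ sumBelow N (λ m → pathSum (g m) u l)
    pathSum-sumBelow N g u []      = sym (trans (sumBelow-const N 0) (ℕP.*-zeroʳ N))
    pathSum-sumBelow N g u (w ∷ l) rewrite pathSum-sumBelow N g w l =
      sym (sumBelow-+ N (λ m → g m u w) (λ m → pathSum (g m) w l))

    cycleSum-+ : ∀ f g l → cycleSum (λ a b → f a b + g a b) l ≡ cycleSum f l + cycleSum g l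
    cycleSum-+ f g []      = refl
    cycleSum-+ f g (v ∷ l) = pathSum-+ f g v (l ++ [ v ])

    cycleSum-cong : ∀ {f g} → (∀ a b → f a b ≡ g a b) → ∀ l → cycleSum f l ≡ cycleSum g l
    cycleSum-cong eq []      = refl
    cycleSum-cong eq (v ∷ l) = pathSum-cong eq v (l ++ [ v ])

    cycleSum-mono : ∀ {f g} → (∀ a b → f a b ≤ g a b) → ∀ l → cycleSum f l ≤ cycleSum g l
    cycleSum-mono le []      = z≤n
    cycleSum-mono le (v ∷ l) = pathSum-mono le v (l ++ [ v ])

    cycleSum-*ˡ : ∀ c f l → cycleSum (λ a b → c * f a b) l ≡ c * cycleSum f l
    cycleSum-*ˡ c f []      = sym (ℕP.*-zeroʳ c)
    cycleSum-*ˡ c f (v ∷ l) = pathSum-*ˡ c f v (l ++ [ v ])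

    cycleSum-sumBelow : ∀ N (g : ℕ → A → A → ℕ) l →
      cycleSum (λ a b → sumBelow N (λ m → g m a b)) l ≡ sumBelow N (λ m → cycleSum (g m) l)
    cycleSum-sumBelow N g []      = sym (trans (sumBelow-const N 0) (ℕP.*-zeroʳ N))
    cycleSum-sumBelow N g (v ∷ l) = pathSum-sumBelow N g v (l ++ [ v ])

    odd-pathSum-crosses : ∀ S u l → odd (pathSum (crosses S) u l) ≡ S u xor S (lastOf u l)
    odd-pathSum-crosses S u []      = sym (BoolP.xor-same (S u))
    odd-pathSum-crosses S u (w ∷ l) = begin
      odd (crosses S u w + pathSum (crosses S) w l)               ≡⟨ odd-+ (crosses S u w) _ ⟩
      odd (crosses S u w) xor odd (pathSum (crosses S) w l)       ≡⟨ cong₂ _xor_ (odd-𝟙 (S u xor S w)) (odd-pathSum-crosses S w l) ⟩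
      (S u xor S w) xor (S w xor S (lastOf w l))                  ≡⟨ BoolP.xor-assoc (S u) (S w) _ ⟩
      S u xor (S w xor (S w xor S (lastOf w l)))                  ≡⟨ cong (S u xor_) (BoolP.xor-assoc (S w) (S w) _) ⟨
      S u xor ((S w xor S w) xor S (lastOf w l))                  ≡⟨ cong (λ b → S u xor (b xor S (lastOf w l))) (BoolP.xor-same (S w)) ⟩
      S u xor S (lastOf w l)                                      ∎
      where open ≡-Reasoning

    lastOf-∷ʳ : ∀ u l v → lastOf u (l ++ [ v ]) ≡ v
    lastOf-∷ʳ u []      v = refl
    lastOf-∷ʳ u (w ∷ l) v = lastOf-∷ʳ w l v

    even-cycleSum-crosses : ∀ S l → odd (cycleSum (crosses S) l) ≡ false
    even-cycleSum-crosses S []      = refl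
    even-cycleSum-crosses S (v ∷ l) = begin
      odd (pathSum (crosses S) v (l ++ [ v ]))  ≡⟨ odd-pathSum-crosses S v (l ++ [ v ]) ⟩
      S v xor S (lastOf v (l ++ [ v ]))         ≡⟨ cong (λ z → S v xor S z) (lastOf-∷ʳ v l v) ⟩
      S v xor S v                               ≡⟨ BoolP.xor-same (S v) ⟩
      false                                     ∎
      where open ≡-Reasoning

    1≤pathSum-crosses : ∀ S u l w → w ∈ l → S w ≢ S u → 1 ≤ pathSum (crosses S) u l
    1≤pathSum-crosses S u (x ∷ l) w (here refl) ne rewrite 𝟙-xor-≢ {S u} {S w} (ne ∘ sym) = s≤s z≤n
    1≤pathSum-crosses S u (x ∷ l) w (there w∈l) ne with S x ≟ S u
    ... | yes Sx≡Su = ℕP.≤-trans (1≤pathSum-crosses S x l w w∈l (λ e → ne (trans e Sx≡Su))) (ℕP.m≤n+m _ (crosses S u x))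
    ... | no  Sx≢Su rewrite 𝟙-xor-≢ {S u} {S x} (λ e → Sx≢Su (sym e)) = s≤s z≤n

    -- Even because the walk is closed, positive because it visits both sides.
    2≤cycleSum-crosses : ∀ S l → (∀ a → a ∈ l) → ∀ u w → S u ≡ true → S w ≡ false → 2 ≤ cycleSum (crosses S) l
    2≤cycleSum-crosses S []      covers u w _  _  with covers u
    ... | ()
    2≤cycleSum-crosses S (v ∷ l) covers u w Su Sw = even∧1≤⇒2≤ (even-cycleSum-crosses S (v ∷ l)) 1≤
      where
      off-start : ∀ a → S a ≢ S v → a ∈ l ++ [ v ]
      off-start a ne with covers a
      ... | here refl = ⊥-elim (ne refl)
      ... | there a∈l = ∈P.∈-++⁺ˡ a∈l
      1≤ : 1 ≤ pathSum (crosses S) v (l ++ [ v ])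
      1≤ with S v in Sv
      ... | true  = 1≤pathSum-crosses S v _ w (off-start w Sw≢) Sw≢
        where Sw≢ : S w ≢ S v
              Sw≢ e with trans (sym Sw) (trans e Sv)
              ... | ()
      ... | false = 1≤pathSum-crosses S v _ u (off-start u Su≢) Su≢
        where Su≢ : S u ≢ S v
              Su≢ e with trans (sym Su) (trans e Sv)
              ... | ()

    joins : (A → Bool) → (A → Bool) → A → A → ℕ
    joins P Q u w = 𝟙 ((P u ∧ Q w) ∨ (Q u ∧ P w))

    private
      crosses-∪ : ∀ pu qu pw qw → (pu ∧ qu) ≡ false → (pw ∧ qw) ≡ false →
        𝟙 ((pu ∨ qu) xor (pw ∨ qw)) + 2 * 𝟙 ((pu ∧ qw) ∨ (qu ∧ pw)) ≡ 𝟙 (pu xor pw) + 𝟙 (qu xor qw)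
      crosses-∪ true  true  _     _     ()
      crosses-∪ _     _     true  true  _  ()
      crosses-∪ true  false true  false _  _ = refl
      crosses-∪ true  false false true  _  _ = refl
      crosses-∪ true  false false false _  _ = refl
      crosses-∪ false true  true  false _  _ = refl
      crosses-∪ false true  false true  _  _ = refl
      crosses-∪ false true  false false _  _ = refl
      crosses-∪ false false true  false _  _ = refl
      crosses-∪ false false false true  _  _ = refl
      crosses-∪ false false false false _  _ = refl

    cycleSum-crosses-∪ : ∀ P Q → (∀ u → (P u ∧ Q u) ≡ false) → ∀ l →
      cycleSum (crosses (λ u → P u ∨ Q u)) l + 2 * cycleSum (joins P Q) l ≡ cycleSum (crosses P) l + cycleSum (crosses Q) l
    cycleSum-crosses-∪ P Q disjoint l = begin
      cycleSum (crosses P∪Q) l + 2 * cycleSum (joins P Q) l              ≡⟨ cong (cycleSum (crosses P∪Q) l +_) (cycleSum-*ˡ 2 (joins P Q) l) ⟨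
      cycleSum (crosses P∪Q) l + cycleSum (λ a b → 2 * joins P Q a b) l  ≡⟨ cycleSum-+ (crosses P∪Q) (λ a b → 2 * joins P Q a b) l ⟨
      cycleSum (λ a b → crosses P∪Q a b + 2 * joins P Q a b) l           ≡⟨ cycleSum-cong (λ a b → crosses-∪ (P a) (Q a) (P b) (Q b) (disjoint a) (disjoint b)) l ⟩
      cycleSum (λ a b → crosses P a b + crosses Q a b) l                 ≡⟨ cycleSum-+ (crosses P) (crosses Q) l ⟩
      cycleSum (crosses P) l + cycleSum (crosses Q) l                    ∎
      where
      open ≡-Reasoning
      P∪Q : A → Bool
      P∪Q u = P u ∨ Q u

module PathGraph where

  open import Data.Nat using (zero; suc; _+_; _*_; _≤_; z≤n)
  import Data.Nat.Properties as ℕP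
  open import Data.Nat.Tactic.RingSolver using (solve-∀)
  open import Data.Bool using (Bool; true; false)
  open import Data.Fin using (Fin; fromℕ; inject₁)
  open import Data.List using (tabulate)
  open import Relation.Binary.PropositionalEquality
  open Indicators
  open FinSums
  open ClosedWalks using (pathSum; lastOf)

  isFirst : ∀ {m} → Fin m → Bool
  isFirst Fin.zero    = true
  isFirst (Fin.suc _) = false

  isLast : ∀ {m} → Fin (suc m) → Bool
  isLast {zero}  Fin.zero    = true
  isLast {suc m} Fin.zero    = false
  isLast {suc m} (Fin.suc s) = isLast {m} s

  adjacent : ∀ {m} → Fin m → Fin m → ℕ
  adjacent Fin.zero    Fin.zero    = 0
  adjacent Fin.zero    (Fin.suc t) = 𝟙 (isFirst t)
  adjacent (Fin.suc s) Fin.zero    = 𝟙 (isFirst s)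
  adjacent (Fin.suc s) (Fin.suc t) = adjacent s t

  adjacent-sym : ∀ {m} (s t : Fin m) → adjacent s t ≡ adjacent t s
  adjacent-sym Fin.zero    Fin.zero    = refl
  adjacent-sym Fin.zero    (Fin.suc t) = refl
  adjacent-sym (Fin.suc s) Fin.zero    = refl
  adjacent-sym (Fin.suc s) (Fin.suc t) = adjacent-sym s t

  adjacent≤1 : ∀ {m} (s t : Fin m) → adjacent s t ≤ 1
  adjacent≤1 Fin.zero    Fin.zero    = z≤n
  adjacent≤1 Fin.zero    (Fin.suc t) = 𝟙≤1 (isFirst t)
  adjacent≤1 (Fin.suc s) Fin.zero    = 𝟙≤1 (isFirst s)
  adjacent≤1 (Fin.suc s) (Fin.suc t) = adjacent≤1 s t

  adjacent-irrefl : ∀ {m} (s : Fin m) → adjacent s s ≡ 0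
  adjacent-irrefl Fin.zero    = refl
  adjacent-irrefl (Fin.suc s) = adjacent-irrefl s

  path-degree : ∀ m (s : Fin (suc (suc m))) → sumFin (suc (suc m)) (adjacent s) + 𝟙 (isFirst s) + 𝟙 (isLast s) ≡ 2
  path-degree m       Fin.zero = cong (λ n → 0 + (1 + n) + 1 + 0) (sumFin-zero m (λ _ → refl))
  path-degree zero    (Fin.suc Fin.zero) = refl
  path-degree (suc m) (Fin.suc s) = begin
    (𝟙 (isFirst s) + sumFin (suc (suc m)) (adjacent s)) + 0 + 𝟙 (isLast s)  ≡⟨ swap (𝟙 (isFirst s)) (sumFin (suc (suc m)) (adjacent s)) (𝟙 (isLast s)) ⟩
    sumFin (suc (suc m)) (adjacent s) + 𝟙 (isFirst s) + 𝟙 (isLast s)      ≡⟨ path-degree m s ⟩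
    2                                                                      ∎
    where
    open ≡-Reasoning
    swap : ∀ a b c → (a + b) + 0 + c ≡ b + a + c
    swap = solve-∀

  sum-*-isFirst : ∀ n (h : Fin (suc n) → ℕ) → sumFin (suc n) (λ t → h t * 𝟙 (isFirst t)) ≡ h Fin.zero
  sum-*-isFirst n h = trans (cong₂ _+_ (ℕP.*-identityʳ (h Fin.zero)) (sumFin-zero n (λ t → ℕP.*-zeroʳ (h (Fin.suc t)))))
                            (ℕP.+-identityʳ _)

  sum-*-isLast : ∀ n (h : Fin (suc n) → ℕ) → sumFin (suc n) (λ t → h t * 𝟙 (isLast t)) ≡ h (fromℕ n)
  sum-*-isLast zero    h = trans (ℕP.+-identityʳ _) (ℕP.*-identityʳ _)
  sum-*-isLast (suc n) h = trans (cong (_+ sumFin (suc n) (λ t → h (Fin.suc t) * 𝟙 (isLast t))) (ℕP.*-zeroʳ (h Fin.zero)))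
                                 (sum-*-isLast n (λ t → h (Fin.suc t)))

  sum-*-adjacent : ∀ n (G : Fin (suc n) → Fin (suc n) → ℕ) →
    sumFin (suc n) (λ s → sumFin (suc n) (λ t → G s t * adjacent s t))
      ≡ sumFin n (λ s → G (inject₁ s) (Fin.suc s) + G (Fin.suc s) (inject₁ s))
  sum-*-adjacent zero    G = trans (ℕP.+-identityʳ _) (trans (ℕP.+-identityʳ _) (ℕP.*-zeroʳ (G Fin.zero Fin.zero)))
  sum-*-adjacent (suc n) G = begin
    (G 0F 0F * 0 + sumFin (suc n) (λ t → G 0F (Fin.suc t) * 𝟙 (isFirst t)))
      + sumFin (suc n) (λ s → G (Fin.suc s) 0F * 𝟙 (isFirst s) + sumFin (suc n) (λ t → G (Fin.suc s) (Fin.suc t) * adjacent s t))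
      ≡⟨ cong₂ _+_ (trans (cong (_+ sumFin (suc n) (λ t → G 0F (Fin.suc t) * 𝟙 (isFirst t))) (ℕP.*-zeroʳ (G 0F 0F))) (sum-*-isFirst n (λ t → G 0F (Fin.suc t))))
                   (sumFin-+ (suc n) (λ s → G (Fin.suc s) 0F * 𝟙 (isFirst s)) (λ s → sumFin (suc n) (λ t → G (Fin.suc s) (Fin.suc t) * adjacent s t))) ⟩
    G 0F 1F + (sumFin (suc n) (λ s → G (Fin.suc s) 0F * 𝟙 (isFirst s)) + sumFin (suc n) (λ s → sumFin (suc n) (λ t → G (Fin.suc s) (Fin.suc t) * adjacent s t)))
      ≡⟨ cong (G 0F 1F +_) (cong₂ _+_ (sum-*-isFirst n (λ s → G (Fin.suc s) 0F)) (sum-*-adjacent n (λ s t → G (Fin.suc s) (Fin.suc t)))) ⟩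
    G 0F 1F + (G 1F 0F + sumFin n (λ s → G (Fin.suc (inject₁ s)) (Fin.suc (Fin.suc s)) + G (Fin.suc (Fin.suc s)) (Fin.suc (inject₁ s))))
      ≡⟨ ℕP.+-assoc (G 0F 1F) _ _ ⟨
    _ ∎
    where
    open ≡-Reasoning
    0F 1F : Fin (suc (suc n))
    0F = Fin.zero
    1F = Fin.suc Fin.zero

  endpoints : ∀ {m m′} → Fin (suc m) → Fin (suc m′) → ℕ
  endpoints s t = 𝟙 (isFirst s) * 𝟙 (isFirst t) + 𝟙 (isLast s) * 𝟙 (isLast t)

  endpoints-sym : ∀ {m m′} (s : Fin (suc m)) (t : Fin (suc m′)) → endpoints s t ≡ endpoints t s
  endpoints-sym s t = cong₂ _+_ (ℕP.*-comm (𝟙 (isFirst s)) _) (ℕP.*-comm (𝟙 (isLast s)) _)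

  sum-endpoints : ∀ {m} m′ (s : Fin (suc m)) → sumFin (suc m′) (endpoints s) ≡ 𝟙 (isFirst s) + 𝟙 (isLast s)
  sum-endpoints m′ s = trans (sumFin-+ (suc m′) (λ t → 𝟙 (isFirst s) * 𝟙 (isFirst t)) (λ t → 𝟙 (isLast s) * 𝟙 (isLast t)))
                             (cong₂ _+_ (sum-*-isFirst m′ (λ _ → 𝟙 (isFirst s))) (sum-*-isLast m′ (λ _ → 𝟙 (isLast s))))

  sum-*-endpoints : ∀ m m′ (G : Fin (suc m) → Fin (suc m′) → ℕ) →
    sumFin (suc m) (λ s → sumFin (suc m′) (λ t → G s t * endpoints s t)) ≡ G Fin.zero Fin.zero + G (fromℕ m) (fromℕ m′)
  sum-*-endpoints m m′ G = begin
    sumFin (suc m) (λ s → sumFin (suc m′) (λ t → G s t * endpoints s t))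
      ≡⟨ sumFin-cong (suc m) (λ s → trans (sumFin-cong (suc m′) (λ t → distrib (G s t) (𝟙 (isFirst s)) (𝟙 (isFirst t)) (𝟙 (isLast s)) (𝟙 (isLast t))))
            (sumFin-+ (suc m′) (λ t → (G s t * 𝟙 (isFirst s)) * 𝟙 (isFirst t)) (λ t → (G s t * 𝟙 (isLast s)) * 𝟙 (isLast t)))) ⟩
    sumFin (suc m) (λ s → sumFin (suc m′) (λ t → (G s t * 𝟙 (isFirst s)) * 𝟙 (isFirst t)) + sumFin (suc m′) (λ t → (G s t * 𝟙 (isLast s)) * 𝟙 (isLast t)))
      ≡⟨ sumFin-cong (suc m) (λ s → cong₂ _+_ (sum-*-isFirst m′ (λ t → G s t * 𝟙 (isFirst s))) (sum-*-isLast m′ (λ t → G s t * 𝟙 (isLast s)))) ⟩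
    sumFin (suc m) (λ s → G s Fin.zero * 𝟙 (isFirst s) + G s (fromℕ m′) * 𝟙 (isLast s))
      ≡⟨ sumFin-+ (suc m) (λ s → G s Fin.zero * 𝟙 (isFirst s)) (λ s → G s (fromℕ m′) * 𝟙 (isLast s)) ⟩
    sumFin (suc m) (λ s → G s Fin.zero * 𝟙 (isFirst s)) + sumFin (suc m) (λ s → G s (fromℕ m′) * 𝟙 (isLast s))
      ≡⟨ cong₂ _+_ (sum-*-isFirst m (λ s → G s Fin.zero)) (sum-*-isLast m (λ s → G s (fromℕ m′))) ⟩
    G Fin.zero Fin.zero + G (fromℕ m) (fromℕ m′) ∎
    where
    open ≡-Reasoning
    distrib : ∀ g a b c d → g * (a * b + c * d) ≡ g * a * b + g * c * d
    distrib = solve-∀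

  sumFin≡pathSum : ∀ {A : Set} n (f : A → A → ℕ) (L : Fin (suc n) → A) →
    sumFin n (λ s → f (L (inject₁ s)) (L (Fin.suc s))) ≡ pathSum f (L Fin.zero) (tabulate (λ s → L (Fin.suc s)))
  sumFin≡pathSum zero    f L = refl
  sumFin≡pathSum (suc n) f L = cong (f (L Fin.zero) (L (Fin.suc Fin.zero)) +_) (sumFin≡pathSum n f (λ s → L (Fin.suc s)))

  lastOf-tabulate : ∀ {A : Set} n (L : Fin (suc n) → A) → lastOf (L Fin.zero) (tabulate (λ s → L (Fin.suc s))) ≡ L (fromℕ n)
  lastOf-tabulate zero    L = refl
  lastOf-tabulate (suc n) L = lastOf-tabulate n (λ s → L (Fin.suc s))

module Disagreements where

  open import Data.Nat using (zero; suc; _+_; _*_; _≤_; z≤n; s≤s)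
  import Data.Nat.Properties as ℕP
  open import Data.Bool using (Bool; true; false; not; _xor_)
  open import Data.Empty using (⊥; ⊥-elim)
  open import Relation.Binary.PropositionalEquality
  open Indicators

  disagreements : Bool → Bool → Bool → ℕ
  disagreements a b c = 𝟙 (a xor b) + 𝟙 (a xor c) + 𝟙 (b xor c)

  2≤disagreements : ∀ a b c → (a ≡ b → b ≡ c → ⊥) → 2 ≤ disagreements a b c
  2≤disagreements true  true  true  nonconst = ⊥-elim (nonconst refl refl)
  2≤disagreements false false false nonconst = ⊥-elim (nonconst refl refl)
  2≤disagreements true  true  false _ = s≤s (s≤s z≤n)
  2≤disagreements true  false true  _ = s≤s (s≤s z≤n)
  2≤disagreements true  false false _ = s≤s (s≤s z≤n)
  2≤disagreements false true  true  _ = s≤s (s≤s z≤n)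
  2≤disagreements false true  false _ = s≤s (s≤s z≤n)
  2≤disagreements false false true  _ = s≤s (s≤s z≤n)

  -- Flipping one corner changes exactly two of the three pairs, so one of the two triangles disagrees.
  2≤disagreements-flip₁ : ∀ a b c → 2 ≤ disagreements a b c + disagreements (not a) b c
  2≤disagreements-flip₁ true  true  true  = s≤s (s≤s z≤n)
  2≤disagreements-flip₁ true  true  false = s≤s (s≤s z≤n)
  2≤disagreements-flip₁ true  false true  = s≤s (s≤s z≤n)
  2≤disagreements-flip₁ true  false false = s≤s (s≤s z≤n)
  2≤disagreements-flip₁ false true  true  = s≤s (s≤s z≤n)
  2≤disagreements-flip₁ false true  false = s≤s (s≤s z≤n)
  2≤disagreements-flip₁ false false true  = s≤s (s≤s z≤n)
  2≤disagreements-flip₁ false false false = s≤s (s≤s z≤n)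

  2≤disagreements-flip₂ : ∀ a b c → 2 ≤ disagreements a b c + disagreements a (not b) c
  2≤disagreements-flip₂ true  true  true  = s≤s (s≤s z≤n)
  2≤disagreements-flip₂ true  true  false = s≤s (s≤s z≤n)
  2≤disagreements-flip₂ true  false true  = s≤s (s≤s z≤n)
  2≤disagreements-flip₂ true  false false = s≤s (s≤s z≤n)
  2≤disagreements-flip₂ false true  true  = s≤s (s≤s z≤n)
  2≤disagreements-flip₂ false true  false = s≤s (s≤s z≤n)
  2≤disagreements-flip₂ false false true  = s≤s (s≤s z≤n)
  2≤disagreements-flip₂ false false false = s≤s (s≤s z≤n)

  2≤disagreements-flip₃ : ∀ a b c → 2 ≤ disagreements a b c + disagreements a b (not c)
  2≤disagreements-flip₃ true  true  true  = s≤s (s≤s z≤n)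
  2≤disagreements-flip₃ true  true  false = s≤s (s≤s z≤n)
  2≤disagreements-flip₃ true  false true  = s≤s (s≤s z≤n)
  2≤disagreements-flip₃ true  false false = s≤s (s≤s z≤n)
  2≤disagreements-flip₃ false true  true  = s≤s (s≤s z≤n)
  2≤disagreements-flip₃ false true  false = s≤s (s≤s z≤n)
  2≤disagreements-flip₃ false false true  = s≤s (s≤s z≤n)
  2≤disagreements-flip₃ false false false = s≤s (s≤s z≤n)

  private
    false≡xor⇒≡ : ∀ a b → false ≡ a xor b → b ≡ a
    false≡xor⇒≡ true  true  _ = refl
    false≡xor⇒≡ false false _ = refl

    true≡xor⇒≡not : ∀ a b → true ≡ a xor b → b ≡ not a
    true≡xor⇒≡not true  false _ = refl
    true≡xor⇒≡not false true  _ = refl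

    4≤2*n+e : ∀ n e → 2 ≤ n → 4 ≤ 2 * n + e
    4≤2*n+e n e 2≤n = ℕP.≤-trans (ℕP.*-monoʳ-≤ 2 2≤n) (ℕP.m≤m+n _ e)

  -- cP counts the crossings of a cut along path P, and bP, tP are the sides of the bottom and top end of P.
  -- If no path is crossed, neither triangle of ends lies on one side; if exactly one path is crossed
  -- (an odd number of times), one corner flips between the bottom and the top triangle.
  4≤2*crossings+disagreements : ∀ cX cY cZ bX tX bY tY bZ tZ →
    odd cX ≡ bX xor tX → odd cY ≡ bY xor tY → odd cZ ≡ bZ xor tZ →
    (cX ≡ 0 → cY ≡ 0 → cZ ≡ 0 → bX ≡ bY → bY ≡ bZ → ⊥) →
    4 ≤ 2 * (cX + cY + cZ) + (disagreements bX bY bZ + disagreements tX tY tZ)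
  4≤2*crossings+disagreements zero zero zero bX tX bY tY bZ tZ pX pY pZ nonconst
    rewrite false≡xor⇒≡ bX tX pX | false≡xor⇒≡ bY tY pY | false≡xor⇒≡ bZ tZ pZ =
      ℕP.+-mono-≤ (2≤disagreements bX bY bZ (nonconst refl refl refl)) (2≤disagreements bX bY bZ (nonconst refl refl refl))
  4≤2*crossings+disagreements (suc zero) zero zero bX tX bY tY bZ tZ pX pY pZ _
    rewrite true≡xor⇒≡not bX tX pX | false≡xor⇒≡ bY tY pY | false≡xor⇒≡ bZ tZ pZ = s≤s (s≤s (2≤disagreements-flip₁ bX bY bZ))
  4≤2*crossings+disagreements zero (suc zero) zero bX tX bY tY bZ tZ pX pY pZ _
    rewrite false≡xor⇒≡ bX tX pX | true≡xor⇒≡not bY tY pY | false≡xor⇒≡ bZ tZ pZ = s≤s (s≤s (2≤disagreements-flip₂ bX bY bZ))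
  4≤2*crossings+disagreements zero zero (suc zero) bX tX bY tY bZ tZ pX pY pZ _
    rewrite false≡xor⇒≡ bX tX pX | false≡xor⇒≡ bY tY pY | true≡xor⇒≡not bZ tZ pZ = s≤s (s≤s (2≤disagreements-flip₃ bX bY bZ))
  4≤2*crossings+disagreements cX@(suc (suc _)) cY cZ bX tX bY tY bZ tZ _ _ _ _ =
    4≤2*n+e (cX + cY + cZ) (disagreements bX bY bZ + disagreements tX tY tZ) (s≤s (s≤s z≤n))
  4≤2*crossings+disagreements cX@(suc zero) cY@(suc _) cZ bX tX bY tY bZ tZ _ _ _ _ =
    4≤2*n+e (cX + cY + cZ) (disagreements bX bY bZ + disagreements tX tY tZ) (s≤s (s≤s z≤n))
  4≤2*crossings+disagreements cX@(suc zero) cY@zero cZ@(suc _) bX tX bY tY bZ tZ _ _ _ _ =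
    4≤2*n+e (cX + cY + cZ) (disagreements bX bY bZ + disagreements tX tY tZ) (s≤s (s≤s z≤n))
  4≤2*crossings+disagreements cX@zero cY@(suc (suc _)) cZ bX tX bY tY bZ tZ _ _ _ _ =
    4≤2*n+e (cX + cY + cZ) (disagreements bX bY bZ + disagreements tX tY tZ) (s≤s (s≤s z≤n))
  4≤2*crossings+disagreements cX@zero cY@(suc zero) cZ@(suc _) bX tX bY tY bZ tZ _ _ _ _ =
    4≤2*n+e (cX + cY + cZ) (disagreements bX bY bZ + disagreements tX tY tZ) (s≤s (s≤s z≤n))
  4≤2*crossings+disagreements cX@zero cY@zero cZ@(suc (suc _)) bX tX bY tY bZ tZ _ _ _ _ =
    4≤2*n+e (cX + cY + cZ) (disagreements bX bY bZ + disagreements tX tY tZ) (s≤s (s≤s z≤n))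

module LineCrossings where

  open import Data.Nat using (zero; suc; _+_; _*_; _≤_; _<_; z≤n; s≤s; _≤ᵇ_; _≡ᵇ_)
  import Data.Nat.Properties as ℕP
  open import Data.Nat.Tactic.RingSolver using (solve-∀)
  open import Data.Bool using (Bool; true; false; _xor_; _∧_; _∨_)
  import Data.Bool.Properties as BoolP
  open import Data.List using (List)
  open import Data.List.Membership.Propositional using (_∈_)
  open import Data.Sum using (inj₁; inj₂)
  open import Relation.Nullary using (¬_)
  open import Relation.Binary.PropositionalEquality
  open Indicators
  open Sums
  open ClosedWalks

  *-≤ᵇ-+ : ∀ x g r h → r < h → (x * h ≤ᵇ g * h + r) ≡ (x ≤ᵇ g)
  *-≤ᵇ-+ x g r h r<h with ℕP.≤-<-connex x g
  ... | inj₁ x≤g = trans (≤⇒≤ᵇ≡true (ℕP.≤-trans (ℕP.*-monoˡ-≤ h x≤g) (ℕP.m≤m+n (g * h) r))) (sym (≤⇒≤ᵇ≡true x≤g))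
  ... | inj₂ g<x = trans (≰⇒≤ᵇ≡false xh≰gh+r) (sym (<⇒≤ᵇ≡false g<x))
    where
    xh≰gh+r : ¬ x * h ≤ g * h + r
    xh≰gh+r = ℕP.<⇒≱ (ℕP.≤-trans (ℕP.+-monoʳ-< (g * h) r<h) (subst (_≤ x * h) (ℕP.+-comm h (g * h)) (ℕP.*-monoˡ-≤ h g<x)))

  record Line (V : Set) (height : V → ℕ) : Set where
    field
      size spacing : ℕ
      on          : V → Bool
      index       : V → ℕ
      point       : ∀ a → a ≤ suc size → V
      on-point    : ∀ a a≤ → on (point a a≤) ≡ true
      index-point : ∀ a a≤ → index (point a a≤) ≡ a
      offLine     : V
      on-offLine  : on offLine ≡ false
      height-on   : ∀ u → on u ≡ true → height u ≡ index u * spacing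
      index-on    : ∀ u → on u ≡ true → index u ≤ suc size

  module ForTour {V : Set} {height : V → ℕ} (L : Line V height) (tour : List V) (covers : ∀ a → a ∈ tour) where
    open Line L

    crossings : (V → Bool) → ℕ
    crossings S = cycleSum (crosses S) tour

    crossings-cong : ∀ {S S′} → (∀ u → S u ≡ S′ u) → crossings S ≡ crossings S′
    crossings-cong eq = cycleSum-cong (λ a b → cong₂ (λ x y → 𝟙 (x xor y)) (eq a) (eq b)) tour

    between : ℕ → ℕ → ℕ → Bool
    between a b x = (a ≤ᵇ x) ∧ (x ≤ᵇ b)

    segment : ℕ → ℕ → V → Bool
    segment a b u = on u ∧ between a b (index u)

    spansGap : ℕ → V → V → ℕ
    spansGap g u w = 𝟙 (on u ∧ (on w ∧ ((index u ≤ᵇ g) xor (index w ≤ᵇ g))))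

    gapUnused : ℕ → ℕ
    gapUnused g = 𝟙 (cycleSum (spansGap g) tour ≡ᵇ 0)

    unusedGaps : ℕ → ℕ → ℕ
    unusedGaps lo zero    = 0
    unusedGaps lo (suc n) = gapUnused lo + unusedGaps (suc lo) n

    between-split : ∀ a lo hi x → a ≤ lo → lo < hi → between a hi x ≡ (between a lo x ∨ between (suc lo) hi x)
    between-split a lo hi x a≤lo lo<hi with ℕP.≤-<-connex x lo
    ... | inj₁ x≤lo rewrite ≤⇒≤ᵇ≡true (ℕP.≤-trans x≤lo (ℕP.<⇒≤ lo<hi)) | ≤⇒≤ᵇ≡true x≤lo
                          | <⇒≤ᵇ≡false {suc lo} {x} (s≤s x≤lo) = sym (BoolP.∨-identityʳ _)
    ... | inj₂ lo<x rewrite <⇒≤ᵇ≡false lo<x | ≤⇒≤ᵇ≡true (ℕP.≤-trans a≤lo (ℕP.<⇒≤ lo<x))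
                          | ≤⇒≤ᵇ≡true lo<x = refl

    between-disjoint : ∀ a lo hi x → (between a lo x ∧ between (suc lo) hi x) ≡ false
    between-disjoint a lo hi x with ℕP.≤-<-connex x lo
    ... | inj₁ x≤lo rewrite <⇒≤ᵇ≡false {suc lo} {x} (s≤s x≤lo) = BoolP.∧-zeroʳ _
    ... | inj₂ lo<x rewrite <⇒≤ᵇ≡false lo<x | BoolP.∧-zeroʳ (a ≤ᵇ x) = refl

    segment-split : ∀ a lo hi → a ≤ lo → lo < hi → ∀ u → segment a hi u ≡ (segment a lo u ∨ segment (suc lo) hi u)
    segment-split a lo hi a≤lo lo<hi u with on u
    ... | true  = between-split a lo hi (index u) a≤lo lo<hi
    ... | false = refl

    segment-disjoint : ∀ a lo hi u → (segment a lo u ∧ segment (suc lo) hi u) ≡ false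
    segment-disjoint a lo hi u with on u
    ... | true  = between-disjoint a lo hi (index u)
    ... | false = refl

    joins-between≤ : ∀ a lo hi x y →
      𝟙 ((between a lo x ∧ between (suc lo) hi y) ∨ (between (suc lo) hi x ∧ between a lo y)) ≤ 𝟙 ((x ≤ᵇ lo) xor (y ≤ᵇ lo))
    joins-between≤ a lo hi x y with ℕP.≤-<-connex x lo | ℕP.≤-<-connex y lo
    ... | inj₁ x≤lo | inj₁ y≤lo
      rewrite <⇒≤ᵇ≡false {suc lo} {x} (s≤s x≤lo) | <⇒≤ᵇ≡false {suc lo} {y} (s≤s y≤lo)
            | BoolP.∧-zeroʳ (between a lo x) = z≤n
    ... | inj₁ x≤lo | inj₂ lo<y rewrite ≤⇒≤ᵇ≡true x≤lo | <⇒≤ᵇ≡false lo<y = 𝟙≤1 _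
    ... | inj₂ lo<x | inj₁ y≤lo rewrite ≤⇒≤ᵇ≡true y≤lo | <⇒≤ᵇ≡false lo<x = 𝟙≤1 _
    ... | inj₂ lo<x | inj₂ lo<y
      rewrite <⇒≤ᵇ≡false lo<x | <⇒≤ᵇ≡false lo<y | BoolP.∧-zeroʳ (a ≤ᵇ x) | BoolP.∧-zeroʳ (a ≤ᵇ y)
            | BoolP.∧-zeroʳ (between (suc lo) hi x) = z≤n

    joins-segments≤spansGap : ∀ a lo hi u w → joins (segment a lo) (segment (suc lo) hi) u w ≤ spansGap lo u w
    joins-segments≤spansGap a lo hi u w with on u | on w
    ... | true  | true  = joins-between≤ a lo hi (index u) (index w)
    ... | true  | false rewrite BoolP.∧-zeroʳ (between a lo (index u)) | BoolP.∧-zeroʳ (between (suc lo) hi (index u)) = z≤n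
    ... | false | _     = z≤n

    2≤crossings-segment : ∀ a b → a ≤ b → b ≤ suc size → 2 ≤ crossings (segment a b)
    2≤crossings-segment a b a≤b b≤ = 2≤cycleSum-crosses (segment a b) tour covers (point a a≤) offLine in-segment off-segment
      where
      a≤ : a ≤ suc size
      a≤ = ℕP.≤-trans a≤b b≤
      in-segment : segment a b (point a a≤) ≡ true
      in-segment rewrite on-point a a≤ | index-point a a≤ | ≤⇒≤ᵇ≡true (ℕP.≤-refl {a}) | ≤⇒≤ᵇ≡true a≤b = refl
      off-segment : segment a b offLine ≡ false
      off-segment rewrite on-offLine = refl

    -- Cutting the segment [a, lo + n] at every unused gap yields pieces that each cross at least twice
    -- and are not joined by any edge.
    crossings-segment-≥ : ∀ n a lo → a ≤ lo → lo + n ≤ suc size → 2 + 2 * unusedGaps lo n ≤ crossings (segment a (lo + n))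
    crossings-segment-≥ zero a lo a≤lo bd = 2≤crossings-segment a (lo + 0) (ℕP.≤-trans a≤lo (ℕP.m≤m+n lo 0)) bd
    crossings-segment-≥ (suc n) a lo a≤lo bd with cycleSum (spansGap lo) tour in gap-lo
    ... | zero = begin
      2 + 2 * (1 + unusedGaps (suc lo) n)                            ≡⟨ 2+2*[1+x]≡2+[2+2*x] (unusedGaps (suc lo) n) ⟩
      2 + (2 + 2 * unusedGaps (suc lo) n)                            ≤⟨ ℕP.+-mono-≤ (2≤crossings-segment a lo a≤lo lo≤) upper-bound ⟩
      crossings lower + crossings upper                              ≡⟨ cycleSum-crosses-∪ lower upper (segment-disjoint a lo hi) tour ⟨
      crossings lower∪upper + 2 * cycleSum (joins lower upper) tour  ≡⟨ cong (λ z → crossings lower∪upper + 2 * z) no-joins ⟩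
      crossings lower∪upper + 0                                      ≡⟨ ℕP.+-identityʳ _ ⟩
      crossings lower∪upper                                          ≡⟨ crossings-cong (segment-split a lo hi a≤lo lo<hi) ⟨
      crossings (segment a hi)                                       ∎
      where
      open ℕP.≤-Reasoning
      hi : ℕ
      hi = lo + suc n
      lower upper lower∪upper : V → Bool
      lower = segment a lo
      upper = segment (suc lo) hi
      lower∪upper u = lower u ∨ upper u
      2+2*[1+x]≡2+[2+2*x] : ∀ x → 2 + 2 * (1 + x) ≡ 2 + (2 + 2 * x)
      2+2*[1+x]≡2+[2+2*x] = solve-∀
      lo<hi : lo < hi
      lo<hi = subst (lo <_) (sym (ℕP.+-suc lo n)) (s≤s (ℕP.m≤m+n lo n))
      lo≤ : lo ≤ suc size
      lo≤ = ℕP.≤-trans (ℕP.<⇒≤ lo<hi) bd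
      upper-bound : 2 + 2 * unusedGaps (suc lo) n ≤ crossings upper
      upper-bound = subst (λ z → 2 + 2 * unusedGaps (suc lo) n ≤ crossings (segment (suc lo) z)) (sym (ℕP.+-suc lo n))
                (crossings-segment-≥ n (suc lo) (suc lo) ℕP.≤-refl (subst (_≤ suc size) (ℕP.+-suc lo n) bd))
      no-joins : cycleSum (joins lower upper) tour ≡ 0
      no-joins = ℕP.n≤0⇒n≡0 (subst (cycleSum (joins lower upper) tour ≤_) gap-lo
                   (cycleSum-mono (joins-segments≤spansGap a lo hi) tour))
    ... | suc _ = subst (λ z → 2 + 2 * unusedGaps (suc lo) n ≤ crossings (segment a z)) (sym (ℕP.+-suc lo n))
                    (crossings-segment-≥ n a (suc lo) (ℕP.m≤n⇒m≤1+n a≤lo) (subst (_≤ suc size) (ℕP.+-suc lo n) bd))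

    crossesLevel : ℕ → V → V → ℕ
    crossesLevel lv u w = 𝟙 (on u ∧ (on w ∧ ((height u ≤ᵇ lv) xor (height w ≤ᵇ lv))))

    levelUnused : ℕ → ℕ
    levelUnused lv = 𝟙 (cycleSum (crossesLevel lv) tour ≡ᵇ 0)

    crossesLevel≡spansGap : ∀ g r → r < spacing → ∀ u w → crossesLevel (g * spacing + r) u w ≡ spansGap g u w
    crossesLevel≡spansGap g r r<h u w with on u in on-u | on w in on-w
    ... | true  | true  rewrite height-on u on-u | height-on w on-w
                              | *-≤ᵇ-+ (index u) g r spacing r<h | *-≤ᵇ-+ (index w) g r spacing r<h = refl
    ... | true  | false = refl
    ... | false | _     = refl

    unusedGaps≡sumBelow : ∀ n lo → unusedGaps lo n ≡ sumBelow n (λ g → gapUnused (lo + g))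
    unusedGaps≡sumBelow zero    lo = refl
    unusedGaps≡sumBelow (suc n) lo = begin
      gapUnused lo + unusedGaps (suc lo) n                          ≡⟨ cong (_+ unusedGaps (suc lo) n) (cong gapUnused (ℕP.+-identityʳ lo)) ⟨
      gapUnused (lo + 0) + unusedGaps (suc lo) n                    ≡⟨ cong (gapUnused (lo + 0) +_) (unusedGaps≡sumBelow n (suc lo)) ⟩
      gapUnused (lo + 0) + sumBelow n (λ g → gapUnused (suc lo + g)) ≡⟨ cong (gapUnused (lo + 0) +_) (sumBelow-cong n (λ g _ → cong gapUnused (ℕP.+-suc lo g))) ⟨
      gapUnused (lo + 0) + sumBelow n (λ g → gapUnused (lo + suc g)) ≡⟨ sumBelow-split 1 n (λ g → gapUnused (lo + g)) ⟨
      sumBelow (suc n) (λ g → gapUnused (lo + g))                   ∎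
      where open ≡-Reasoning

    sum-levelUnused : sumBelow (suc size * spacing) levelUnused ≡ spacing * unusedGaps 0 (suc size)
    sum-levelUnused = begin
      sumBelow (suc size * spacing) levelUnused                                   ≡⟨ sumBelow-blocks (suc size) spacing levelUnused ⟩
      sumBelow (suc size) (λ g → sumBelow spacing (λ r → levelUnused (g * spacing + r)))
        ≡⟨ sumBelow-cong (suc size) (λ g _ → sumBelow-cong spacing (λ r r<h →
             cong (λ z → 𝟙 (z ≡ᵇ 0)) (cycleSum-cong (crossesLevel≡spansGap g r r<h) tour))) ⟩
      sumBelow (suc size) (λ g → sumBelow spacing (λ _ → gapUnused g))             ≡⟨ sumBelow-cong (suc size) (λ g _ → sumBelow-const spacing (gapUnused g)) ⟩
      sumBelow (suc size) (λ g → spacing * gapUnused g)                           ≡⟨ sumBelow-*ˡ (suc size) spacing gapUnused ⟩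
      spacing * sumBelow (suc size) gapUnused                                     ≡⟨ cong (spacing *_) (unusedGaps≡sumBelow (suc size) 0) ⟨
      spacing * unusedGaps 0 (suc size)                                           ∎
      where open ≡-Reasoning

    segment-whole : ∀ u → segment 0 (0 + suc size) u ≡ on u
    segment-whole u with on u in on-u
    ... | true  rewrite ≤⇒≤ᵇ≡true (index-on u on-u) = refl
    ... | false = refl

    line-crossings-bound : 2 * sumBelow (suc size * spacing) levelUnused + 2 * spacing ≤ spacing * crossings on
    line-crossings-bound = begin
      2 * sumBelow (suc size * spacing) levelUnused + 2 * spacing ≡⟨ cong (λ z → 2 * z + 2 * spacing) sum-levelUnused ⟩
      2 * (spacing * unusedGaps 0 (suc size)) + 2 * spacing     ≡⟨ 2*[h*x]+2*h≡h*[2+2*x] spacing (unusedGaps 0 (suc size)) ⟩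
      spacing * (2 + 2 * unusedGaps 0 (suc size))               ≤⟨ ℕP.*-monoʳ-≤ spacing (crossings-segment-≥ (suc size) 0 0 z≤n ℕP.≤-refl) ⟩
      spacing * crossings (segment 0 (0 + suc size))            ≡⟨ cong (spacing *_) (crossings-cong segment-whole) ⟩
      spacing * crossings on                                    ∎
      where
      open ℕP.≤-Reasoning
      2*[h*x]+2*h≡h*[2+2*x] : ∀ h x → 2 * (h * x) + 2 * h ≡ h * (2 + 2 * x)
      2*[h*x]+2*h≡h*[2+2*x] = solve-∀

module LevelCuts where

  open import Data.Nat using (zero; suc; _+_; _∸_; _≤_; z≤n; _≤ᵇ_; ∣_-_∣)
  import Data.Nat.Properties as ℕP
  open import Data.Bool using (_xor_)
  import Data.Bool.Properties as BoolP
  open import Data.Sum using (inj₁; inj₂)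
  open import Relation.Binary.PropositionalEquality
  open Indicators
  open Sums

  separates : ℕ → ℕ → ℕ → ℕ
  separates a b lv = 𝟙 ((a ≤ᵇ lv) xor (b ≤ᵇ lv))

  separates≤ : ∀ a b lv → a ≤ b → separates a b lv ≤ 𝟙 (a ≤ᵇ lv)
  separates≤ a b lv a≤b with ℕP.≤-<-connex a lv
  ... | inj₁ a≤lv rewrite ≤⇒≤ᵇ≡true a≤lv = 𝟙≤1 _
  ... | inj₂ lv<a rewrite <⇒≤ᵇ≡false lv<a | <⇒≤ᵇ≡false (ℕP.<-≤-trans lv<a a≤b) = z≤n

  separates-above : ∀ a b lv → a ≤ b → b ≤ lv → separates a b lv ≡ 0
  separates-above a b lv a≤b b≤lv rewrite ≤⇒≤ᵇ≡true (ℕP.≤-trans a≤b b≤lv) | ≤⇒≤ᵇ≡true b≤lv = refl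

  sum-separates≤∸ : ∀ a b N → a ≤ b → sumBelow N (separates a b) ≤ N ∸ a
  sum-separates≤∸ a b zero    a≤b = z≤n
  sum-separates≤∸ a b (suc N) a≤b with ℕP.≤-<-connex a N
  ... | inj₁ a≤N = begin
    sumBelow N (separates a b) + separates a b N  ≤⟨ ℕP.+-mono-≤ (sum-separates≤∸ a b N a≤b) (separates≤ a b N a≤b) ⟩
    N ∸ a + 𝟙 (a ≤ᵇ N)                            ≡⟨ cong (λ z → N ∸ a + 𝟙 z) (≤⇒≤ᵇ≡true a≤N) ⟩
    N ∸ a + 1                                     ≡⟨ ℕP.+-comm (N ∸ a) 1 ⟩
    suc (N ∸ a)                                   ≡⟨ ℕP.+-∸-assoc 1 a≤N ⟨
    suc N ∸ a                                     ∎
    where open ℕP.≤-Reasoning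
  ... | inj₂ N<a = begin
    sumBelow N (separates a b) + separates a b N  ≤⟨ ℕP.+-mono-≤ (sum-separates≤∸ a b N a≤b) (separates≤ a b N a≤b) ⟩
    N ∸ a + 𝟙 (a ≤ᵇ N)                            ≡⟨ cong₂ (λ x y → x + 𝟙 y) (ℕP.m≤n⇒m∸n≡0 (ℕP.<⇒≤ N<a)) (<⇒≤ᵇ≡false N<a) ⟩
    0                                             ≡⟨ ℕP.m≤n⇒m∸n≡0 N<a ⟨
    suc N ∸ a                                     ∎
    where open ℕP.≤-Reasoning

  sum-separates-above : ∀ a b k → a ≤ b → sumBelow (b + k) (separates a b) ≡ sumBelow b (separates a b)
  sum-separates-above a b k a≤b = begin
    sumBelow (b + k) (separates a b)                                        ≡⟨ sumBelow-split b k (separates a b) ⟩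
    sumBelow b (separates a b) + sumBelow k (λ r → separates a b (b + r))   ≡⟨ cong (sumBelow b (separates a b) +_) vanish ⟩
    sumBelow b (separates a b) + 0                                          ≡⟨ ℕP.+-identityʳ _ ⟩
    sumBelow b (separates a b)                                              ∎
    where
    open ≡-Reasoning
    vanish : sumBelow k (λ r → separates a b (b + r)) ≡ 0
    vanish = trans (sumBelow-cong k (λ r _ → separates-above a b (b + r) a≤b (ℕP.m≤m+n b r)))
                   (trans (sumBelow-const k 0) (ℕP.*-zeroʳ k))

  sum-separates≤∸-ordered : ∀ a b N → a ≤ b → sumBelow N (separates a b) ≤ b ∸ a
  sum-separates≤∸-ordered a b N a≤b with ℕP.≤-total N b
  ... | inj₁ N≤b = ℕP.≤-trans (sum-separates≤∸ a b N a≤b) (ℕP.∸-monoˡ-≤ a N≤b)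
  ... | inj₂ b≤N = subst (λ z → sumBelow z (separates a b) ≤ b ∸ a) (ℕP.m+[n∸m]≡n b≤N)
                     (ℕP.≤-trans (ℕP.≤-reflexive (sum-separates-above a b (N ∸ b) a≤b)) (sum-separates≤∸ a b b a≤b))

  sum-separates≤∣-∣ : ∀ a b N → sumBelow N (separates a b) ≤ ∣ a - b ∣
  sum-separates≤∣-∣ a b N with ℕP.≤-total a b
  ... | inj₁ a≤b = subst (sumBelow N (separates a b) ≤_) (sym (ℕP.m≤n⇒∣m-n∣≡n∸m a≤b)) (sum-separates≤∸-ordered a b N a≤b)
  ... | inj₂ b≤a = subst₂ _≤_ (sumBelow-cong N (λ lv _ → cong 𝟙 (BoolP.xor-comm (b ≤ᵇ lv) (a ≤ᵇ lv))))
                              (sym (ℕP.m≤n⇒∣n-m∣≡n∸m b≤a)) (sum-separates≤∸-ordered b a N b≤a)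

-- Multiplying all coordinates of I³ by D = (i+1)(j+1)(k+1) makes them natural numbers:
-- X_s = (0, 0, sA), Y_s = (A + B, 0, sB), Z_s = (A, C, sC) with A = D/(i+1), B = D/(j+1), C = D/(k+1).
module ScaledInstance (i j k : ℕ) where

  open import Data.Nat using (suc; _+_; _*_; _≤_; ∣_-_∣; s≤s)
  import Data.Nat.Properties as ℕP
  open import Data.Nat.Tactic.RingSolver using (solve-∀)
  open import Data.Bool using (Bool; true; false)
  open import Data.Fin using (Fin; toℕ; fromℕ<)
  import Data.Fin.Properties as FinP
  open import Data.Sum using (inj₁; inj₂)
  open import Relation.Binary.PropositionalEquality
  open LineCrossings using (Line)
  open ClosedWalks using (crosses)

  A B C D : ℕ
  A = suc j * suc k
  B = suc i * suc k
  C = suc i * suc j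
  D = suc i * A

  D≡[1+j]*B : D ≡ suc j * B
  D≡[1+j]*B = lemma i j k
    where
    lemma : ∀ i j k → suc i * (suc j * suc k) ≡ suc j * (suc i * suc k)
    lemma = solve-∀

  D≡[1+k]*C : D ≡ suc k * C
  D≡[1+k]*C = lemma i j k
    where
    lemma : ∀ i j k → suc i * (suc j * suc k) ≡ suc k * (suc i * suc j)
    lemma = solve-∀

  Vertex : Set
  Vertex = V i j k

  x y z : Vertex → ℕ
  x (inj₁ _)        = 0
  x (inj₂ (inj₁ _)) = A + B
  x (inj₂ (inj₂ _)) = A
  y (inj₁ _)        = 0
  y (inj₂ (inj₁ _)) = 0
  y (inj₂ (inj₂ _)) = C
  z (inj₁ s)        = toℕ s * A
  z (inj₂ (inj₁ s)) = toℕ s * B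
  z (inj₂ (inj₂ s)) = toℕ s * C

  dist : Vertex → Vertex → ℕ
  dist u w = ∣ x u - x w ∣ + ∣ y u - y w ∣ + ∣ z u - z w ∣

  onX onY onZ : Vertex → Bool
  onX (inj₁ _)        = true
  onX (inj₂ _)        = false
  onY (inj₂ (inj₁ _)) = true
  onY _               = false
  onZ (inj₂ (inj₂ _)) = true
  onZ _               = false

  index : Vertex → ℕ
  index (inj₁ s)        = toℕ s
  index (inj₂ (inj₁ s)) = toℕ s
  index (inj₂ (inj₂ s)) = toℕ s

  lineX : Line Vertex z
  lineX = record
    { size = i ; spacing = A ; on = onX ; index = index
    ; point = λ a a≤ → inj₁ (fromℕ< (s≤s a≤))
    ; on-point = λ _ _ → refl
    ; index-point = λ a a≤ → FinP.toℕ-fromℕ< (s≤s a≤)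
    ; offLine = inj₂ (inj₁ Fin.zero) ; on-offLine = refl
    ; height-on = height ; index-on = index≤ }
    where
    height : ∀ u → onX u ≡ true → z u ≡ index u * A
    height (inj₁ _) _ = refl
    index≤ : ∀ u → onX u ≡ true → index u ≤ suc i
    index≤ (inj₁ s) _ = FinP.toℕ≤pred[n] s

  lineY : Line Vertex z
  lineY = record
    { size = j ; spacing = B ; on = onY ; index = index
    ; point = λ a a≤ → inj₂ (inj₁ (fromℕ< (s≤s a≤)))
    ; on-point = λ _ _ → refl
    ; index-point = λ a a≤ → FinP.toℕ-fromℕ< (s≤s a≤)
    ; offLine = inj₁ Fin.zero ; on-offLine = refl
    ; height-on = height ; index-on = index≤ }
    where
    height : ∀ u → onY u ≡ true → z u ≡ index u * B
    height (inj₂ (inj₁ _)) _ = refl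
    index≤ : ∀ u → onY u ≡ true → index u ≤ suc j
    index≤ (inj₂ (inj₁ s)) _ = FinP.toℕ≤pred[n] s

  lineZ : Line Vertex z
  lineZ = record
    { size = k ; spacing = C ; on = onZ ; index = index
    ; point = λ a a≤ → inj₂ (inj₂ (fromℕ< (s≤s a≤)))
    ; on-point = λ _ _ → refl
    ; index-point = λ a a≤ → FinP.toℕ-fromℕ< (s≤s a≤)
    ; offLine = inj₁ Fin.zero ; on-offLine = refl
    ; height-on = height ; index-on = index≤ }
    where
    height : ∀ u → onZ u ≡ true → z u ≡ index u * C
    height (inj₂ (inj₂ _)) _ = refl
    index≤ : ∀ u → onZ u ≡ true → index u ≤ suc k
    index≤ (inj₂ (inj₂ s)) _ = FinP.toℕ≤pred[n] s

  horizontalPart : Vertex → Vertex → ℕ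
  horizontalPart u w = A * crosses onX u w + B * crosses onY u w + C * crosses onZ u w

  private
    noCrossing : ∀ a b c → 0 ≡ a * 0 + b * 0 + c * 0
    noCrossing = solve-∀
    crossXY : ∀ a b c → (a + b) + 0 ≡ a * 1 + b * 1 + c * 0
    crossXY = solve-∀
    crossXZ : ∀ a b c → a + c ≡ a * 1 + b * 0 + c * 1
    crossXZ = solve-∀
    crossYZ : ∀ a b c → b + c ≡ a * 0 + b * 1 + c * 1
    crossYZ = solve-∀

  -- The three lines lie over the corners (0,0), (A+B,0) and (A,C) of a triangle whose sides
  -- have ℓ₁-lengths A + B, A + C and B + C.
  horizontal-dist : ∀ u w → ∣ x u - x w ∣ + ∣ y u - y w ∣ ≡ horizontalPart u w
  horizontal-dist (inj₁ _)        (inj₁ _)        = noCrossing A B C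
  horizontal-dist (inj₁ _)        (inj₂ (inj₁ _)) = crossXY A B C
  horizontal-dist (inj₁ _)        (inj₂ (inj₂ _)) = crossXZ A B C
  horizontal-dist (inj₂ (inj₁ _)) (inj₁ _)        = trans (cong (_+ 0) (ℕP.∣-∣-identityʳ (A + B))) (crossXY A B C)
  horizontal-dist (inj₂ (inj₁ _)) (inj₂ (inj₁ _)) = trans (cong (_+ 0) (ℕP.∣n-n∣≡0 (A + B))) (noCrossing A B C)
  horizontal-dist (inj₂ (inj₁ _)) (inj₂ (inj₂ _)) = trans (cong (_+ C) (trans (ℕP.∣-∣-comm (A + B) A) (ℕP.∣m-m+n∣≡n A B))) (crossYZ A B C)
  horizontal-dist (inj₂ (inj₂ _)) (inj₁ _)        = trans (cong₂ _+_ (ℕP.∣-∣-identityʳ A) (ℕP.∣-∣-identityʳ C)) (crossXZ A B C)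
  horizontal-dist (inj₂ (inj₂ _)) (inj₂ (inj₁ _)) = trans (cong₂ _+_ (ℕP.∣m-m+n∣≡n A B) (ℕP.∣-∣-identityʳ C)) (crossYZ A B C)
  horizontal-dist (inj₂ (inj₂ _)) (inj₂ (inj₂ _)) = trans (cong₂ _+_ (ℕP.∣n-n∣≡0 A) (ℕP.∣n-n∣≡0 C)) (noCrossing A B C)

  dist≡horizontal+vertical : ∀ u w → dist u w ≡ horizontalPart u w + ∣ z u - z w ∣
  dist≡horizontal+vertical u w = cong (_+ ∣ z u - z w ∣) (horizontal-dist u w)

module TourBound (i j k : ℕ) (H : Tour i j k) where

  open import Data.Nat using (zero; suc; _+_; _*_; _≤_; _<_; z≤n; s≤s; _≤ᵇ_; _≡ᵇ_; ∣_-_∣)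
  import Data.Nat.Properties as ℕP
  open import Data.Nat.Tactic.RingSolver using (solve-∀)
  open import Data.Bool using (Bool; false)
  open import Data.Fin using (Fin; fromℕ)
  import Data.Fin.Properties as FinP
  open import Data.Sum using (inj₁; inj₂)
  open import Relation.Binary.PropositionalEquality
  open Indicators
  open Sums
  open ClosedWalks
  open LevelCuts
  open ScaledInstance i j k
  open Tour H renaming (order to tour; complete to covers)
  module LX = LineCrossings.ForTour lineX tour covers
  module LY = LineCrossings.ForTour lineY tour covers
  module LZ = LineCrossings.ForTour lineZ tour covers
  open LX using (crossings)

  below : ℕ → Vertex → Bool
  below lv u = z u ≤ᵇ lv

  edgeLowerBound : Vertex → Vertex → ℕ
  edgeLowerBound u w = sumBelow D (λ lv → crosses (below lv) u w) + horizontalPart u w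

  edgeLowerBound≤dist : ∀ u w → edgeLowerBound u w ≤ dist u w
  edgeLowerBound≤dist u w = begin
    sumBelow D (λ lv → crosses (below lv) u w) + horizontalPart u w  ≤⟨ ℕP.+-monoˡ-≤ (horizontalPart u w) (sum-separates≤∣-∣ (z u) (z w) D) ⟩
    ∣ z u - z w ∣ + horizontalPart u w                                ≡⟨ ℕP.+-comm (∣ z u - z w ∣) (horizontalPart u w) ⟩
    horizontalPart u w + ∣ z u - z w ∣                                ≡⟨ dist≡horizontal+vertical u w ⟨
    dist u w                                                          ∎
    where open ℕP.≤-Reasoning

  tourLength≥cuts : sumBelow D (λ lv → crossings (below lv)) + (A * crossings onX + B * crossings onY + C * crossings onZ)
                      ≤ cycleSum dist tour
  tourLength≥cuts = begin
    sumBelow D (λ lv → crossings (below lv)) + (A * crossings onX + B * crossings onY + C * crossings onZ)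
      ≡⟨ cong₂ _+_ (cycleSum-sumBelow D (λ lv → crosses (below lv)) tour) horizontal ⟨
    cycleSum (λ u w → sumBelow D (λ lv → crosses (below lv) u w)) tour + cycleSum horizontalPart tour
      ≡⟨ cycleSum-+ (λ u w → sumBelow D (λ lv → crosses (below lv) u w)) horizontalPart tour ⟨
    cycleSum edgeLowerBound tour
      ≤⟨ cycleSum-mono edgeLowerBound≤dist tour ⟩
    cycleSum dist tour ∎
    where
    open ℕP.≤-Reasoning
    horizontal : cycleSum horizontalPart tour ≡ A * crossings onX + B * crossings onY + C * crossings onZ
    horizontal = trans (cycleSum-+ (λ u w → A * crosses onX u w + B * crosses onY u w) (λ u w → C * crosses onZ u w) tour)
      (cong₂ _+_ (trans (cycleSum-+ (λ u w → A * crosses onX u w) (λ u w → B * crosses onY u w) tour)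
                        (cong₂ _+_ (cycleSum-*ˡ A (crosses onX) tour) (cycleSum-*ˡ B (crosses onY) tour)))
                 (cycleSum-*ˡ C (crosses onZ) tour))

  lineEdges≤crosses-below : ∀ lv u w → LX.crossesLevel lv u w + LY.crossesLevel lv u w + LZ.crossesLevel lv u w ≤ crosses (below lv) u w
  lineEdges≤crosses-below lv (inj₁ _)        (inj₁ _)        = ℕP.≤-reflexive (trans (ℕP.+-identityʳ _) (ℕP.+-identityʳ _))
  lineEdges≤crosses-below lv (inj₁ _)        (inj₂ _)        = z≤n
  lineEdges≤crosses-below lv (inj₂ (inj₁ _)) (inj₁ _)        = z≤n
  lineEdges≤crosses-below lv (inj₂ (inj₁ _)) (inj₂ (inj₁ _)) = ℕP.≤-reflexive (ℕP.+-identityʳ _)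
  lineEdges≤crosses-below lv (inj₂ (inj₁ _)) (inj₂ (inj₂ _)) = z≤n
  lineEdges≤crosses-below lv (inj₂ (inj₂ _)) (inj₁ _)        = z≤n
  lineEdges≤crosses-below lv (inj₂ (inj₂ _)) (inj₂ (inj₁ _)) = z≤n
  lineEdges≤crosses-below lv (inj₂ (inj₂ _)) (inj₂ (inj₂ _)) = ℕP.≤-refl

  lineEdges≤crossings-below : ∀ lv →
    cycleSum (LX.crossesLevel lv) tour + cycleSum (LY.crossesLevel lv) tour + cycleSum (LZ.crossesLevel lv) tour ≤ crossings (below lv)
  lineEdges≤crossings-below lv = begin
    cycleSum (LX.crossesLevel lv) tour + cycleSum (LY.crossesLevel lv) tour + cycleSum (LZ.crossesLevel lv) tour
      ≡⟨ cong (_+ cycleSum (LZ.crossesLevel lv) tour) (cycleSum-+ (LX.crossesLevel lv) (LY.crossesLevel lv) tour) ⟨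
    cycleSum (λ u w → LX.crossesLevel lv u w + LY.crossesLevel lv u w) tour + cycleSum (LZ.crossesLevel lv) tour
      ≡⟨ cycleSum-+ (λ u w → LX.crossesLevel lv u w + LY.crossesLevel lv u w) (LZ.crossesLevel lv) tour ⟨
    cycleSum (λ u w → LX.crossesLevel lv u w + LY.crossesLevel lv u w + LZ.crossesLevel lv u w) tour
      ≤⟨ cycleSum-mono (lineEdges≤crosses-below lv) tour ⟩
    crossings (below lv) ∎
    where open ℕP.≤-Reasoning

  2≤crossings-below : ∀ lv → lv < D → 2 ≤ crossings (below lv)
  2≤crossings-below lv lv<D = 2≤cycleSum-crosses (below lv) tour covers (inj₁ Fin.zero) (inj₁ (fromℕ (suc i))) refl top-above
    where
    top-above : below lv (inj₁ (fromℕ (suc i))) ≡ false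
    top-above rewrite FinP.toℕ-fromℕ i = <⇒≤ᵇ≡false lv<D

  private
    4≤c+2*suc : ∀ {c t} → 2 ≤ c → 4 ≤ c + 2 * suc t
    4≤c+2*suc {t = t} 2≤c = ℕP.+-mono-≤ 2≤c (ℕP.*-monoʳ-≤ 2 (s≤s (z≤n {t})))

  -- If all three lines have an edge across a level, its even crossing number is at least three, hence four.
  even-cut-bound : ∀ c ex ey ez → odd c ≡ false → 2 ≤ c → ex + ey + ez ≤ c →
    4 ≤ c + 2 * (𝟙 (ex ≡ᵇ 0) + 𝟙 (ey ≡ᵇ 0) + 𝟙 (ez ≡ᵇ 0))
  even-cut-bound c zero     ey       ez       _    2≤c _ = 4≤c+2*suc 2≤c
  even-cut-bound c (suc _)  zero     ez       _    2≤c _ = 4≤c+2*suc 2≤c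
  even-cut-bound c (suc _)  (suc _)  zero     _    2≤c _ = 4≤c+2*suc {t = 0} 2≤c
  even-cut-bound c (suc ex) (suc ey) (suc ez) even _   le =
    ℕP.≤-trans (even∧3≤⇒4≤ even (ℕP.≤-trans (ℕP.+-mono-≤ (ℕP.+-mono-≤ (s≤s (z≤n {ex})) (s≤s (z≤n {ey}))) (s≤s (z≤n {ez}))) le))
               (ℕP.m≤m+n c _)

  level-bound : ∀ lv → lv < D → 4 ≤ crossings (below lv) + 2 * (LX.levelUnused lv + LY.levelUnused lv + LZ.levelUnused lv)
  level-bound lv lv<D = even-cut-bound (crossings (below lv))
    (cycleSum (LX.crossesLevel lv) tour) (cycleSum (LY.crossesLevel lv) tour) (cycleSum (LZ.crossesLevel lv) tour)
    (even-cycleSum-crosses (below lv) tour) (2≤crossings-below lv lv<D) (lineEdges≤crossings-below lv)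

  sum-level-bound : D * 4 ≤ sumBelow D (λ lv → crossings (below lv))
                             + 2 * (sumBelow D LX.levelUnused + sumBelow D LY.levelUnused + sumBelow D LZ.levelUnused)
  sum-level-bound = begin
    D * 4                                                                   ≡⟨ sumBelow-const D 4 ⟨
    sumBelow D (λ _ → 4)                                                    ≤⟨ sumBelow-mono D level-bound ⟩
    sumBelow D (λ lv → crossings (below lv) + 2 * unused lv)                ≡⟨ sumBelow-+ D (λ lv → crossings (below lv)) (λ lv → 2 * unused lv) ⟩
    sumBelow D (λ lv → crossings (below lv)) + sumBelow D (λ lv → 2 * unused lv)
      ≡⟨ cong (sumBelow D (λ lv → crossings (below lv)) +_) (trans (sumBelow-*ˡ D 2 unused) (cong (2 *_) split)) ⟩
    sumBelow D (λ lv → crossings (below lv)) + 2 * (sumBelow D LX.levelUnused + sumBelow D LY.levelUnused + sumBelow D LZ.levelUnused) ∎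
    where
    open ℕP.≤-Reasoning
    unused : ℕ → ℕ
    unused lv = LX.levelUnused lv + LY.levelUnused lv + LZ.levelUnused lv
    split : sumBelow D unused ≡ sumBelow D LX.levelUnused + sumBelow D LY.levelUnused + sumBelow D LZ.levelUnused
    split = trans (sumBelow-+ D (λ lv → LX.levelUnused lv + LY.levelUnused lv) LZ.levelUnused)
                  (cong (_+ sumBelow D LZ.levelUnused) (sumBelow-+ D LX.levelUnused LY.levelUnused))

  line-bounds : (2 * sumBelow D LX.levelUnused + 2 * A) + (2 * sumBelow D LY.levelUnused + 2 * B) + (2 * sumBelow D LZ.levelUnused + 2 * C)
                  ≤ A * crossings onX + B * crossings onY + C * crossings onZ
  line-bounds = ℕP.+-mono-≤ (ℕP.+-mono-≤ LX.line-crossings-bound boundY) boundZ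
    where
    boundY : 2 * sumBelow D LY.levelUnused + 2 * B ≤ B * crossings onY
    boundY = subst (λ n → 2 * sumBelow n LY.levelUnused + 2 * B ≤ B * crossings onY) (sym D≡[1+j]*B) LY.line-crossings-bound
    boundZ : 2 * sumBelow D LZ.levelUnused + 2 * C ≤ C * crossings onZ
    boundZ = subst (λ n → 2 * sumBelow n LZ.levelUnused + 2 * C ≤ C * crossings onZ) (sym D≡[1+k]*C) LZ.line-crossings-bound

  tourLength-≥ : D * 4 + 2 * (A + B + C) ≤ cycleSum dist tour
  tourLength-≥ = begin
    D * 4 + 2 * (A + B + C)                                              ≤⟨ ℕP.+-monoˡ-≤ (2 * (A + B + C)) sum-level-bound ⟩
    levels + 2 * (ux + uy + uz) + 2 * (A + B + C)                        ≡⟨ regroup levels ux uy uz A B C ⟩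
    levels + ((2 * ux + 2 * A) + (2 * uy + 2 * B) + (2 * uz + 2 * C))   ≤⟨ ℕP.+-monoʳ-≤ levels line-bounds ⟩
    levels + (A * crossings onX + B * crossings onY + C * crossings onZ) ≤⟨ tourLength≥cuts ⟩
    cycleSum dist tour                                                   ∎
    where
    open ℕP.≤-Reasoning
    levels ux uy uz : ℕ
    levels = sumBelow D (λ lv → crossings (below lv))
    ux = sumBelow D LX.levelUnused
    uy = sumBelow D LY.levelUnused
    uz = sumBelow D LZ.levelUnused
    regroup : ∀ s x y z a b c → s + 2 * (x + y + z) + 2 * (a + b + c) ≡ s + ((2 * x + 2 * a) + (2 * y + 2 * b) + (2 * z + 2 * c))
    regroup = solve-∀

module VertexSums where

  open import Data.Nat using (suc; _+_; _*_)
  import Data.Nat.Properties as ℕP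
  open import Data.Bool using (Bool; true; false; not)
  import Data.Bool as Bool
  open import Data.Sum using (inj₁; inj₂)
  open import Data.List using (List; []; _∷_; _++_; map; tabulate; foldr; filter)
  open import Data.Fin using (Fin)
  open import Data.Rational as ℚ using (ℚ; 0ℚ)
  open import Relation.Binary.PropositionalEquality
  open import Relation.Nullary using (yes; no)
  open Indicators
  open Fractions
  open FinSums

  sumℚ-cong : ∀ {A : Set} {f g : A → ℚ} → (∀ a → f a ≡ g a) → ∀ l → sumℚ f l ≡ sumℚ g l
  sumℚ-cong eq []      = refl
  sumℚ-cong eq (x ∷ l) = cong₂ ℚ._+_ (eq x) (sumℚ-cong eq l)

  sumℚ-÷ : ∀ {A : Set} d (g : A → ℕ) l → sumℚ (λ a → g a ÷ suc d) l ≡ sumList g l ÷ suc d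
  sumℚ-÷ d g []      = sym (0÷ d)
  sumℚ-÷ d g (x ∷ l) = trans (cong (g x ÷ suc d ℚ.+_) (sumℚ-÷ d g l)) (÷-+-same (g x) (sumList g l) d)

  foldr-step-cong : ∀ {A : Set} {φ : A → ℚ → ℚ} (g : A → ℚ) → (∀ a r → φ a r ≡ g a ℚ.+ r) → ∀ l → foldr φ 0ℚ l ≡ sumℚ g l
  foldr-step-cong g eq []      = refl
  foldr-step-cong {φ = φ} g eq (x ∷ l) = trans (cong (φ x) (foldr-step-cong g eq l)) (eq x (sumℚ g l))

  -- The summand of sumOthers is local to its definition, so the type of step≡ is left to unification.
  -- That only succeeds on a part of allV that does not compute, hence the two concrete first vertices
  -- are split off by hand.
  module _ {i j k : ℕ} (u : V i j k) (f : V i j k → ℚ) (fu≡0 : f u ≡ 0ℚ) where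

    step≡ : ∀ v r → _ ≡ f v ℚ.+ r

    private
      x₀ x₁ : V i j k
      x₀ = inj₁ Fin.zero
      x₁ = inj₁ (Fin.suc Fin.zero)

      rest : List (V i j k)
      rest = map inj₁ (tabulate {n = i} (λ s → Fin.suc (Fin.suc s)))
             ++ (map (λ s → inj₂ (inj₁ s)) (allFinL (suc (suc j))) ++ map (λ s → inj₂ (inj₂ s)) (allFinL (suc (suc k))))

      self : ∀ {v} → u ≡ v → 0ℚ ≡ f v
      self refl = sym fu≡0

      rest≡ : ∀ c₀ c₁ {φ} → foldr φ 0ℚ rest ≡ sumℚ f rest →
              c₀ ℚ.+ (c₁ ℚ.+ foldr φ 0ℚ rest) ≡ c₀ ℚ.+ (c₁ ℚ.+ sumℚ f rest)
      rest≡ c₀ c₁ eq = cong (λ t → c₀ ℚ.+ (c₁ ℚ.+ t)) eq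

    sumOthers≡sumℚ : sumOthers u f ≡ sumℚ f (allV i j k)
    sumOthers≡sumℚ with u ≟V x₀ | u ≟V x₁
    ... | yes p | yes q = trans (rest≡ 0ℚ 0ℚ (foldr-step-cong f step≡ rest))
                                (cong₂ (λ a b → a ℚ.+ (b ℚ.+ sumℚ f rest)) (self p) (self q))
    ... | yes p | no _  = trans (rest≡ 0ℚ (f x₁) (foldr-step-cong f step≡ rest))
                                (cong (λ a → a ℚ.+ (f x₁ ℚ.+ sumℚ f rest)) (self p))
    ... | no _  | yes q = trans (rest≡ (f x₀) 0ℚ (foldr-step-cong f step≡ rest))
                                (cong (λ b → f x₀ ℚ.+ (b ℚ.+ sumℚ f rest)) (self q))
    ... | no _  | no _  = rest≡ (f x₀) (f x₁) (foldr-step-cong f step≡ rest)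

    step≡ v r with u ≟V v
    ... | yes refl = cong (ℚ._+ r) (sym fu≡0)
    ... | no  _    = refl

  sumV : ∀ {i j k} → (V i j k → ℕ) → ℕ
  sumV {i} {j} {k} g = sumFin (suc (suc i)) (λ s → g (inj₁ s))
                       + (sumFin (suc (suc j)) (λ s → g (inj₂ (inj₁ s))) + sumFin (suc (suc k)) (λ s → g (inj₂ (inj₂ s))))

  sumList-allV : ∀ {i j k} (g : V i j k → ℕ) → sumList g (allV i j k) ≡ sumV g
  sumList-allV {i} {j} {k} g =
    trans (sumList-++ g (map inj₁ (allFinL _)) _)
          (cong₂ _+_ (sumList-map-tabulate (suc (suc i)) g inj₁ (λ s → s))
                     (trans (sumList-++ g (map (λ s → inj₂ (inj₁ s)) (allFinL _)) _)
                            (cong₂ _+_ (sumList-map-tabulate (suc (suc j)) g (λ s → inj₂ (inj₁ s)) (λ s → s))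
                                       (sumList-map-tabulate (suc (suc k)) g (λ s → inj₂ (inj₂ s)) (λ s → s)))))

  sumV-cong : ∀ {i j k} {f g : V i j k → ℕ} → (∀ a → f a ≡ g a) → sumV f ≡ sumV g
  sumV-cong {i} {j} {k} eq =
    cong₂ _+_ (sumFin-cong (suc (suc i)) (λ s → eq (inj₁ s)))
              (cong₂ _+_ (sumFin-cong (suc (suc j)) (λ s → eq (inj₂ (inj₁ s)))) (sumFin-cong (suc (suc k)) (λ s → eq (inj₂ (inj₂ s)))))

  sumV-*ˡ : ∀ {i j k} c (f : V i j k → ℕ) → sumV (λ a → c * f a) ≡ c * sumV f
  sumV-*ˡ {i} {j} {k} c f =
    trans (cong₂ _+_ (sumFin-*ˡ (suc (suc i)) c fx) (cong₂ _+_ (sumFin-*ˡ (suc (suc j)) c fy) (sumFin-*ˡ (suc (suc k)) c fz)))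
          (trans (cong (c * sumFin (suc (suc i)) fx +_) (sym (ℕP.*-distribˡ-+ c (sumFin _ fy) (sumFin _ fz))))
                 (sym (ℕP.*-distribˡ-+ c (sumFin _ fx) _)))
    where
    fx : Fin (suc (suc i)) → ℕ
    fx s = f (inj₁ s)
    fy : Fin (suc (suc j)) → ℕ
    fy s = f (inj₂ (inj₁ s))
    fz : Fin (suc (suc k)) → ℕ
    fz s = f (inj₂ (inj₂ s))

  sumList-filter-true : ∀ {A : Set} (S : A → Bool) (g : A → ℕ) l →
    sumList g (filter (λ w → S w Bool.≟ true) l) ≡ sumList (λ w → 𝟙 (S w) * g w) l
  sumList-filter-true S g []      = refl
  sumList-filter-true S g (x ∷ l) with S x
  ... | true  = cong₂ _+_ (sym (ℕP.+-identityʳ (g x))) (sumList-filter-true S g l)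
  ... | false = sumList-filter-true S g l

  sumList-filter-false : ∀ {A : Set} (S : A → Bool) (g : A → ℕ) l →
    sumList g (filter (λ w → S w Bool.≟ false) l) ≡ sumList (λ w → 𝟙 (not (S w)) * g w) l
  sumList-filter-false S g []      = refl
  sumList-filter-false S g (x ∷ l) with S x
  ... | false = cong₂ _+_ (sym (ℕP.+-identityʳ (g x))) (sumList-filter-false S g l)
  ... | true  = sumList-filter-false S g l

-- The LP solution: value 1 on the edges of the three vertical paths and 1/2 on the edges of the bottom
-- triangle X₀Y₀Z₀ and the top triangle.  The function support stores twice these values.
module Support (i j k : ℕ) where

  open import Data.Nat using (suc; _+_; _*_; _≤_; z≤n)
  import Data.Nat.Properties as ℕP
  open import Data.Nat.Tactic.RingSolver using (solve-∀)
  open import Data.Bool using (true; false)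
  open import Data.Fin using (Fin; fromℕ; inject₁)
  open import Data.Sum using (inj₁; inj₂)
  open import Relation.Binary.PropositionalEquality
  open Indicators
  open FinSums
  open PathGraph
  open VertexSums using (sumV)
  open ScaledInstance i j k using (Vertex)

  X : Fin (suc (suc i)) → Vertex
  X = inj₁
  Y : Fin (suc (suc j)) → Vertex
  Y s = inj₂ (inj₁ s)
  Z : Fin (suc (suc k)) → Vertex
  Z s = inj₂ (inj₂ s)

  support : Vertex → Vertex → ℕ
  support (inj₁ s)        (inj₁ t)        = 2 * adjacent s t
  support (inj₁ s)        (inj₂ (inj₁ t)) = endpoints s t
  support (inj₁ s)        (inj₂ (inj₂ t)) = endpoints s t
  support (inj₂ (inj₁ s)) (inj₁ t)        = endpoints s t
  support (inj₂ (inj₁ s)) (inj₂ (inj₁ t)) = 2 * adjacent s t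
  support (inj₂ (inj₁ s)) (inj₂ (inj₂ t)) = endpoints s t
  support (inj₂ (inj₂ s)) (inj₁ t)        = endpoints s t
  support (inj₂ (inj₂ s)) (inj₂ (inj₁ t)) = endpoints s t
  support (inj₂ (inj₂ s)) (inj₂ (inj₂ t)) = 2 * adjacent s t

  support-sym : ∀ u w → support u w ≡ support w u
  support-sym (inj₁ s)        (inj₁ t)        = cong (2 *_) (adjacent-sym s t)
  support-sym (inj₁ s)        (inj₂ (inj₁ t)) = endpoints-sym s t
  support-sym (inj₁ s)        (inj₂ (inj₂ t)) = endpoints-sym s t
  support-sym (inj₂ (inj₁ s)) (inj₁ t)        = endpoints-sym s t
  support-sym (inj₂ (inj₁ s)) (inj₂ (inj₁ t)) = cong (2 *_) (adjacent-sym s t)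
  support-sym (inj₂ (inj₁ s)) (inj₂ (inj₂ t)) = endpoints-sym s t
  support-sym (inj₂ (inj₂ s)) (inj₁ t)        = endpoints-sym s t
  support-sym (inj₂ (inj₂ s)) (inj₂ (inj₁ t)) = endpoints-sym s t
  support-sym (inj₂ (inj₂ s)) (inj₂ (inj₂ t)) = cong (2 *_) (adjacent-sym s t)

  private
    endpoints≤2 : ∀ {m m′} (s : Fin (suc m)) (t : Fin (suc m′)) → endpoints s t ≤ 2
    endpoints≤2 s t = ℕP.+-mono-≤ (𝟙*𝟙≤1 (isFirst s) (isFirst t)) (𝟙*𝟙≤1 (isLast s) (isLast t))
      where
      𝟙*𝟙≤1 : ∀ a b → 𝟙 a * 𝟙 b ≤ 1
      𝟙*𝟙≤1 true  b = ℕP.≤-trans (ℕP.≤-reflexive (ℕP.+-identityʳ (𝟙 b))) (𝟙≤1 b)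
      𝟙*𝟙≤1 false _ = z≤n

    2*adjacent≤2 : ∀ {m} (s t : Fin m) → 2 * adjacent s t ≤ 2
    2*adjacent≤2 s t = ℕP.*-monoʳ-≤ 2 (adjacent≤1 s t)

  support≤2 : ∀ u w → support u w ≤ 2
  support≤2 (inj₁ s)        (inj₁ t)        = 2*adjacent≤2 s t
  support≤2 (inj₁ s)        (inj₂ (inj₁ t)) = endpoints≤2 s t
  support≤2 (inj₁ s)        (inj₂ (inj₂ t)) = endpoints≤2 s t
  support≤2 (inj₂ (inj₁ s)) (inj₁ t)        = endpoints≤2 s t
  support≤2 (inj₂ (inj₁ s)) (inj₂ (inj₁ t)) = 2*adjacent≤2 s t
  support≤2 (inj₂ (inj₁ s)) (inj₂ (inj₂ t)) = endpoints≤2 s t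
  support≤2 (inj₂ (inj₂ s)) (inj₁ t)        = endpoints≤2 s t
  support≤2 (inj₂ (inj₂ s)) (inj₂ (inj₁ t)) = endpoints≤2 s t
  support≤2 (inj₂ (inj₂ s)) (inj₂ (inj₂ t)) = 2*adjacent≤2 s t

  support-irrefl : ∀ u → support u u ≡ 0
  support-irrefl (inj₁ s)        = cong (2 *_) (adjacent-irrefl s)
  support-irrefl (inj₂ (inj₁ s)) = cong (2 *_) (adjacent-irrefl s)
  support-irrefl (inj₂ (inj₂ s)) = cong (2 *_) (adjacent-irrefl s)

  sum-support : ∀ v → sumV (support v) ≡ 4
  sum-support (inj₁ s) = begin
    sumFin (suc (suc i)) (λ t → 2 * adjacent s t) + (sumFin (suc (suc j)) (endpoints s) + sumFin (suc (suc k)) (endpoints s))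
      ≡⟨ cong₂ _+_ (sumFin-*ˡ (suc (suc i)) 2 (adjacent s)) (cong₂ _+_ (sum-endpoints (suc j) s) (sum-endpoints (suc k) s)) ⟩
    2 * a + ((f + l) + (f + l))   ≡⟨ regroup a f l ⟩
    2 * (a + f + l)               ≡⟨ cong (2 *_) (path-degree i s) ⟩
    4                             ∎
    where
    open ≡-Reasoning
    a f l : ℕ
    a = sumFin (suc (suc i)) (adjacent s)
    f = 𝟙 (isFirst s)
    l = 𝟙 (isLast s)
    regroup : ∀ a f l → 2 * a + ((f + l) + (f + l)) ≡ 2 * (a + f + l)
    regroup = solve-∀
  sum-support (inj₂ (inj₁ s)) = begin
    sumFin (suc (suc i)) (endpoints s) + (sumFin (suc (suc j)) (λ t → 2 * adjacent s t) + sumFin (suc (suc k)) (endpoints s))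
      ≡⟨ cong₂ _+_ (sum-endpoints (suc i) s) (cong₂ _+_ (sumFin-*ˡ (suc (suc j)) 2 (adjacent s)) (sum-endpoints (suc k) s)) ⟩
    (f + l) + (2 * a + (f + l))   ≡⟨ regroup a f l ⟩
    2 * (a + f + l)               ≡⟨ cong (2 *_) (path-degree j s) ⟩
    4                             ∎
    where
    open ≡-Reasoning
    a f l : ℕ
    a = sumFin (suc (suc j)) (adjacent s)
    f = 𝟙 (isFirst s)
    l = 𝟙 (isLast s)
    regroup : ∀ a f l → (f + l) + (2 * a + (f + l)) ≡ 2 * (a + f + l)
    regroup = solve-∀
  sum-support (inj₂ (inj₂ s)) = begin
    sumFin (suc (suc i)) (endpoints s) + (sumFin (suc (suc j)) (endpoints s) + sumFin (suc (suc k)) (λ t → 2 * adjacent s t))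
      ≡⟨ cong₂ _+_ (sum-endpoints (suc i) s) (cong₂ _+_ (sum-endpoints (suc j) s) (sumFin-*ˡ (suc (suc k)) 2 (adjacent s))) ⟩
    (f + l) + ((f + l) + 2 * a)   ≡⟨ regroup a f l ⟩
    2 * (a + f + l)               ≡⟨ cong (2 *_) (path-degree k s) ⟩
    4                             ∎
    where
    open ≡-Reasoning
    a f l : ℕ
    a = sumFin (suc (suc k)) (adjacent s)
    f = 𝟙 (isFirst s)
    l = 𝟙 (isLast s)
    regroup : ∀ a f l → (f + l) + ((f + l) + 2 * a) ≡ 2 * (a + f + l)
    regroup = solve-∀

  along : ∀ {m} → (Fin (suc (suc m)) → Vertex) → (Vertex → Vertex → ℕ) → ℕ
  along {m} L G = sumFin (suc m) (λ s → 2 * G (L (inject₁ s)) (L (Fin.suc s)) + 2 * G (L (Fin.suc s)) (L (inject₁ s)))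

  ends : ∀ {m m′} → (Fin (suc m) → Vertex) → (Fin (suc m′) → Vertex) → (Vertex → Vertex → ℕ) → ℕ
  ends {m} {m′} L L′ G = G (L Fin.zero) (L′ Fin.zero) + G (L (fromℕ m)) (L′ (fromℕ m′))

  private
    sum-*-2*adjacent : ∀ n (G : Fin (suc n) → Fin (suc n) → ℕ) →
      sumFin (suc n) (λ s → sumFin (suc n) (λ t → G s t * (2 * adjacent s t)))
        ≡ sumFin n (λ s → 2 * G (inject₁ s) (Fin.suc s) + 2 * G (Fin.suc s) (inject₁ s))
    sum-*-2*adjacent n G = trans (sumFin-cong (suc n) (λ s → sumFin-cong (suc n) (λ t → reassoc (G s t) (adjacent s t))))
                                 (sum-*-adjacent n (λ s t → 2 * G s t))
      where
      reassoc : ∀ g a → g * (2 * a) ≡ (2 * g) * a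
      reassoc = solve-∀

    sum-split₃ : ∀ n (a b c : Fin n → ℕ) → sumFin n (λ s → a s + (b s + c s)) ≡ sumFin n a + (sumFin n b + sumFin n c)
    sum-split₃ n a b c = trans (sumFin-+ n a (λ s → b s + c s)) (cong (sumFin n a +_) (sumFin-+ n b c))

  sum-*-support : ∀ G → sumV (λ u → sumV (λ w → G u w * support u w))
    ≡ (along X G + (ends X Y G + ends X Z G)) + ((ends Y X G + (along Y G + ends Y Z G)) + (ends Z X G + (ends Z Y G + along Z G)))
  sum-*-support G = cong₂ _+_ rowX (cong₂ _+_ rowY rowZ)
    where
    rowX : sumFin (suc (suc i)) (λ s → sumV (λ w → G (X s) w * support (X s) w)) ≡ along X G + (ends X Y G + ends X Z G)
    rowX = trans (sum-split₃ (suc (suc i)) (λ s → sumFin (suc (suc i)) (λ t → G (X s) (X t) * support (X s) (X t)))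
                                      (λ s → sumFin (suc (suc j)) (λ t → G (X s) (Y t) * support (X s) (Y t)))
                                      (λ s → sumFin (suc (suc k)) (λ t → G (X s) (Z t) * support (X s) (Z t))))
                 (cong₂ _+_ (sum-*-2*adjacent (suc i) (λ s t → G (X s) (X t)))
                            (cong₂ _+_ (sum-*-endpoints (suc i) (suc j) (λ s t → G (X s) (Y t)))
                                       (sum-*-endpoints (suc i) (suc k) (λ s t → G (X s) (Z t)))))
    rowY : sumFin (suc (suc j)) (λ s → sumV (λ w → G (Y s) w * support (Y s) w)) ≡ ends Y X G + (along Y G + ends Y Z G)
    rowY = trans (sum-split₃ (suc (suc j)) (λ s → sumFin (suc (suc i)) (λ t → G (Y s) (X t) * support (Y s) (X t)))
                                      (λ s → sumFin (suc (suc j)) (λ t → G (Y s) (Y t) * support (Y s) (Y t)))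
                                      (λ s → sumFin (suc (suc k)) (λ t → G (Y s) (Z t) * support (Y s) (Z t))))
                 (cong₂ _+_ (sum-*-endpoints (suc j) (suc i) (λ s t → G (Y s) (X t)))
                            (cong₂ _+_ (sum-*-2*adjacent (suc j) (λ s t → G (Y s) (Y t)))
                                       (sum-*-endpoints (suc j) (suc k) (λ s t → G (Y s) (Z t)))))
    rowZ : sumFin (suc (suc k)) (λ s → sumV (λ w → G (Z s) w * support (Z s) w)) ≡ ends Z X G + (ends Z Y G + along Z G)
    rowZ = trans (sum-split₃ (suc (suc k)) (λ s → sumFin (suc (suc i)) (λ t → G (Z s) (X t) * support (Z s) (X t)))
                                      (λ s → sumFin (suc (suc j)) (λ t → G (Z s) (Y t) * support (Z s) (Y t)))
                                      (λ s → sumFin (suc (suc k)) (λ t → G (Z s) (Z t) * support (Z s) (Z t))))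
                 (cong₂ _+_ (sum-*-endpoints (suc k) (suc i) (λ s t → G (Z s) (X t)))
                            (cong₂ _+_ (sum-*-endpoints (suc k) (suc j) (λ s t → G (Z s) (Y t)))
                                       (sum-*-2*adjacent (suc k) (λ s t → G (Z s) (Z t)))))

module LPSolution (i j k : ℕ) where

  open import Data.Nat using (zero; suc; _+_; _*_; _≤_; z≤n)
  import Data.Nat.Properties as ℕP
  open import Data.Nat.Tactic.RingSolver using (solve-∀)
  open import Data.Bool using (Bool; true; false; not; _xor_; _≟_)
  open import Data.Fin using (Fin; fromℕ; inject₁)
  open import Data.List using (List; tabulate; filter)
  import Data.List.Membership.Propositional.Properties as ∈P
  open import Data.Sum using (inj₁; inj₂)
  open import Data.Product using (_,_; ∃)
  open import Data.Empty using (⊥; ⊥-elim)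
  open import Data.Rational as ℚ using (ℚ; 0ℚ; 1ℚ)
  open import Relation.Nullary using (yes; no)
  open import Relation.Binary.PropositionalEquality
  open Indicators
  open import Algebra.Properties.CommutativeSemigroup ℕP.+-commutativeSemigroup using (interchange)
  open Fractions
  open FinSums
  open ClosedWalks
  open PathGraph
  open VertexSums
  open Disagreements
  open ScaledInstance i j k using (Vertex)
  open Support i j k

  lpSolution : Vertex → Vertex → ℚ
  lpSolution u w = support u w ÷ 2

  lpSolution-irrefl : ∀ u → lpSolution u u ≡ 0ℚ
  lpSolution-irrefl u = trans (cong (_÷ 2) (support-irrefl u)) (0÷ 1)

  two≡4÷2 : two ≡ 4 ÷ 2
  two≡4÷2 = ÷-cross-≡ 2 4 0 1 refl

  lpSolution-degree : ∀ v → sumOthers v (lpSolution v) ≡ two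
  lpSolution-degree v = begin
    sumOthers v (lpSolution v)                          ≡⟨ sumOthers≡sumℚ v (lpSolution v) (lpSolution-irrefl v) ⟩
    sumℚ (λ w → support v w ÷ 2) (allV i j k)           ≡⟨ sumℚ-÷ 1 (support v) (allV i j k) ⟩
    sumList (support v) (allV i j k) ÷ 2                ≡⟨ cong (_÷ 2) (trans (sumList-allV (support v)) (sum-support v)) ⟩
    4 ÷ 2                                               ≡⟨ two≡4÷2 ⟨
    two                                                 ∎
    where open ≡-Reasoning

  lpSolution≤1 : ∀ u w → lpSolution u w ℚ.≤ 1ℚ
  lpSolution≤1 u w = subst (lpSolution u w ℚ.≤_) (÷-cross-≡ 2 1 1 0 refl) (÷-monoˡ-≤ 1 (support≤2 u w))

  0≤lpSolution : ∀ u w → 0ℚ ℚ.≤ lpSolution u w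
  0≤lpSolution u w = ÷-nonNeg (support u w) 1

  module SubtourCut (S : Vertex → Bool) where

    leaves : Vertex → Vertex → ℕ
    leaves u w = 𝟙 (S u) * 𝟙 (not (S w))

    cutCount : ℕ
    cutCount = sumV (λ u → sumV (λ w → leaves u w * support u w))

    cutValue≡cutCount÷2 : cutValue S lpSolution ≡ cutCount ÷ 2
    cutValue≡cutCount÷2 = begin
      sumℚ (λ u → sumℚ (lpSolution u) outside) inside            ≡⟨ sumℚ-cong (λ u → sumℚ-÷ 1 (support u) outside) inside ⟩
      sumℚ (λ u → sumList (support u) outside ÷ 2) inside        ≡⟨ sumℚ-÷ 1 (λ u → sumList (support u) outside) inside ⟩
      sumList (λ u → sumList (support u) outside) inside ÷ 2     ≡⟨ cong (_÷ 2) count ⟩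
      cutCount ÷ 2                                               ∎
      where
      open ≡-Reasoning
      inside outside : List Vertex
      inside = filter (λ w → S w ≟ true) (allV i j k)
      outside = filter (λ w → S w ≟ false) (allV i j k)
      count : sumList (λ u → sumList (support u) outside) inside ≡ cutCount
      count = begin
        sumList (λ u → sumList (support u) outside) inside
          ≡⟨ sumList-filter-true S (λ u → sumList (support u) outside) (allV i j k) ⟩
        sumList (λ u → 𝟙 (S u) * sumList (support u) outside) (allV i j k)
          ≡⟨ sumList-allV (λ u → 𝟙 (S u) * sumList (support u) outside) ⟩
        sumV (λ u → 𝟙 (S u) * sumList (support u) outside)
          ≡⟨ sumV-cong (λ u → cong (𝟙 (S u) *_) (trans (sumList-filter-false S (support u) (allV i j k))
                                                      (sumList-allV (λ w → 𝟙 (not (S w)) * support u w)))) ⟩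
        sumV (λ u → 𝟙 (S u) * sumV (λ w → 𝟙 (not (S w)) * support u w))
          ≡⟨ sumV-cong (λ u → trans (sym (sumV-*ˡ (𝟙 (S u)) (λ w → 𝟙 (not (S w)) * support u w)))
                                    (sumV-cong (λ w → sym (ℕP.*-assoc (𝟙 (S u)) (𝟙 (not (S w))) (support u w))))) ⟩
        cutCount ∎

    pathCrossings : ∀ {m} → (Fin (suc (suc m)) → Vertex) → ℕ
    pathCrossings {m} L = sumFin (suc m) (λ s → crosses S (L (inject₁ s)) (L (Fin.suc s)))

    odd-pathCrossings : ∀ {m} (L : Fin (suc (suc m)) → Vertex) → odd (pathCrossings L) ≡ S (L Fin.zero) xor S (L (fromℕ (suc m)))
    odd-pathCrossings {m} L = begin
      odd (pathCrossings L)                                                        ≡⟨ cong odd (sumFin≡pathSum (suc m) (crosses S) L) ⟩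
      odd (pathSum (crosses S) (L Fin.zero) (tabulate (λ s → L (Fin.suc s))))      ≡⟨ odd-pathSum-crosses S (L Fin.zero) (tabulate (λ s → L (Fin.suc s))) ⟩
      S (L Fin.zero) xor S (lastOf (L Fin.zero) (tabulate (λ s → L (Fin.suc s)))) ≡⟨ cong (λ v → S (L Fin.zero) xor S v) (lastOf-tabulate (suc m) L) ⟩
      S (L Fin.zero) xor S (L (fromℕ (suc m)))                                     ∎
      where open ≡-Reasoning

    uncrossed⇒constant : ∀ {m} (L : Fin (suc (suc m)) → Vertex) → pathCrossings L ≡ 0 → ∀ s → S (L s) ≡ S (L Fin.zero)
    uncrossed⇒constant L _  Fin.zero    = refl
    uncrossed⇒constant {m} L ≡0 (Fin.suc s) with S (L (Fin.suc s)) ≟ S (L Fin.zero)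
    ... | yes same = same
    ... | no  diff = ⊥-elim (ℕP.<⇒≱ (ℕP.≤-trans 1≤ (ℕP.≤-reflexive (trans (sym (sumFin≡pathSum (suc m) (crosses S) L)) ≡0))) z≤n)
      where
      1≤ : 1 ≤ pathSum (crosses S) (L Fin.zero) (tabulate (λ t → L (Fin.suc t)))
      1≤ = 1≤pathSum-crosses S (L Fin.zero) (tabulate (λ t → L (Fin.suc t))) (L (Fin.suc s)) (∈P.∈-tabulate⁺ {f = λ t → L (Fin.suc t)} s) diff

    leaves-pair : ∀ u w → leaves u w + leaves w u ≡ crosses S u w
    leaves-pair u w with S u | S w
    ... | true  | true  = refl
    ... | true  | false = refl
    ... | false | true  = refl
    ... | false | false = refl

    along-leaves : ∀ {m} (L : Fin (suc (suc m)) → Vertex) → along L leaves ≡ 2 * pathCrossings L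
    along-leaves {m} L = trans (sumFin-cong (suc m) (λ s → trans (sym (ℕP.*-distribˡ-+ 2 (leaves (L (inject₁ s)) (L (Fin.suc s))) _))
                                                                 (cong (2 *_) (leaves-pair (L (inject₁ s)) (L (Fin.suc s))))))
                               (sumFin-*ˡ (suc m) 2 (λ s → crosses S (L (inject₁ s)) (L (Fin.suc s))))

    ends-leaves : ∀ {m m′} (P : Fin (suc m) → Vertex) (Q : Fin (suc m′) → Vertex) →
      ends P Q leaves + ends Q P leaves ≡ crosses S (P Fin.zero) (Q Fin.zero) + crosses S (P (fromℕ m)) (Q (fromℕ m′))
    ends-leaves {m} {m′} P Q = trans (interchange (leaves (P Fin.zero) (Q Fin.zero)) (leaves (P (fromℕ m)) (Q (fromℕ m′)))
                                                              (leaves (Q Fin.zero) (P Fin.zero)) (leaves (Q (fromℕ m′)) (P (fromℕ m))))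
                                     (cong₂ _+_ (leaves-pair (P Fin.zero) (Q Fin.zero)) (leaves-pair (P (fromℕ m)) (Q (fromℕ m′))))

    bottom top : ∀ {m} → (Fin (suc (suc m)) → Vertex) → Bool
    bottom L = S (L Fin.zero)
    top {m} L = S (L (fromℕ (suc m)))

    cutCount≡ : cutCount ≡ 2 * (pathCrossings X + pathCrossings Y + pathCrossings Z)
                           + (disagreements (bottom X) (bottom Y) (bottom Z) + disagreements (top X) (top Y) (top Z))
    cutCount≡ = begin
      cutCount
        ≡⟨ sum-*-support leaves ⟩
      (along X leaves + (ends X Y leaves + ends X Z leaves)) + ((ends Y X leaves + (along Y leaves + ends Y Z leaves))
        + (ends Z X leaves + (ends Z Y leaves + along Z leaves)))
        ≡⟨ cong₂ (λ a b → (a + (ends X Y leaves + ends X Z leaves)) + b) (along-leaves X)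
             (cong₂ (λ a b → (ends Y X leaves + (a + ends Y Z leaves)) + (ends Z X leaves + (ends Z Y leaves + b))) (along-leaves Y) (along-leaves Z)) ⟩
      (2 * pathCrossings X + (ends X Y leaves + ends X Z leaves)) + ((ends Y X leaves + (2 * pathCrossings Y + ends Y Z leaves))
        + (ends Z X leaves + (ends Z Y leaves + 2 * pathCrossings Z)))
        ≡⟨ regroup (pathCrossings X) (pathCrossings Y) (pathCrossings Z) (ends X Y leaves) (ends X Z leaves)
                   (ends Y X leaves) (ends Y Z leaves) (ends Z X leaves) (ends Z Y leaves) ⟩
      2 * (pathCrossings X + pathCrossings Y + pathCrossings Z)
        + ((ends X Y leaves + ends Y X leaves) + (ends X Z leaves + ends Z X leaves) + (ends Y Z leaves + ends Z Y leaves))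
        ≡⟨ cong (2 * (pathCrossings X + pathCrossings Y + pathCrossings Z) +_)
             (cong₂ _+_ (cong₂ _+_ (ends-leaves X Y) (ends-leaves X Z)) (ends-leaves Y Z)) ⟩
      2 * (pathCrossings X + pathCrossings Y + pathCrossings Z)
        + ((𝟙 (bottom X xor bottom Y) + 𝟙 (top X xor top Y)) + (𝟙 (bottom X xor bottom Z) + 𝟙 (top X xor top Z))
           + (𝟙 (bottom Y xor bottom Z) + 𝟙 (top Y xor top Z)))
        ≡⟨ cong (2 * (pathCrossings X + pathCrossings Y + pathCrossings Z) +_) (transpose (𝟙 (bottom X xor bottom Y)) (𝟙 (top X xor top Y)) (𝟙 (bottom X xor bottom Z)) (𝟙 (top X xor top Z))
                                                                                         (𝟙 (bottom Y xor bottom Z)) (𝟙 (top Y xor top Z))) ⟩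
      2 * (pathCrossings X + pathCrossings Y + pathCrossings Z)
        + (disagreements (bottom X) (bottom Y) (bottom Z) + disagreements (top X) (top Y) (top Z)) ∎
      where
      open ≡-Reasoning
      regroup : ∀ cx cy cz xy xz yx yz zx zy →
        (2 * cx + (xy + xz)) + ((yx + (2 * cy + yz)) + (zx + (zy + 2 * cz)))
          ≡ 2 * (cx + cy + cz) + ((xy + yx) + (xz + zx) + (yz + zy))
      regroup = solve-∀
      transpose : ∀ b₁ t₁ b₂ t₂ b₃ t₃ → (b₁ + t₁) + (b₂ + t₂) + (b₃ + t₃) ≡ (b₁ + b₂ + b₃) + (t₁ + t₂ + t₃)
      transpose = solve-∀

    4≤cutCount : ∀ {u w} → S u ≡ true → S w ≡ false → 4 ≤ cutCount
    4≤cutCount {u} {w} Su Sw = subst (4 ≤_) (sym cutCount≡)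
      (4≤2*crossings+disagreements (pathCrossings X) (pathCrossings Y) (pathCrossings Z)
        (bottom X) (top X) (bottom Y) (top Y) (bottom Z) (top Z)
        (odd-pathCrossings X) (odd-pathCrossings Y) (odd-pathCrossings Z) nonconstant)
      where
      nonconstant : pathCrossings X ≡ 0 → pathCrossings Y ≡ 0 → pathCrossings Z ≡ 0 →
                    bottom X ≡ bottom Y → bottom Y ≡ bottom Z → ⊥
      nonconstant cX≡0 cY≡0 cZ≡0 bX≡bY bY≡bZ = true≢false (trans (sym Su) (trans (side u) (trans (sym (side w)) Sw)))
        where
        side : ∀ v → S v ≡ bottom X
        side (inj₁ s)        = uncrossed⇒constant X cX≡0 s
        side (inj₂ (inj₁ s)) = trans (uncrossed⇒constant Y cY≡0 s) (sym bX≡bY)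
        side (inj₂ (inj₂ s)) = trans (uncrossed⇒constant Z cZ≡0 s) (sym (trans bX≡bY bY≡bZ))
        true≢false : true ≢ false
        true≢false ()

    two≤cutValue : ∃ (λ u → S u ≡ true) → ∃ (λ w → S w ≡ false) → two ℚ.≤ cutValue S lpSolution
    two≤cutValue (_ , Su) (_ , Sw) = subst₂ ℚ._≤_ (sym two≡4÷2) (sym cutValue≡cutCount÷2) (÷-monoˡ-≤ 1 (4≤cutCount Su Sw))

  lpSolution-feasible : SubtourFeasible i j k lpSolution
  lpSolution-feasible = record
    { symmetric = λ u w → cong (_÷ 2) (support-sym u w)
    ; lower     = λ u w _ → 0≤lpSolution u w
    ; upper     = λ u w _ → lpSolution≤1 u w
    ; degree    = lpSolution-degree
    ; subtour   = SubtourCut.two≤cutValue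
    }

module RationalScaling (i j k : ℕ) where

  open import Data.Nat as ℕ using (suc; _+_; _*_; ∣_-_∣)
  open import Data.Nat.Tactic.RingSolver using (solve-∀)
  open import Data.Fin using (toℕ)
  open import Data.Sum using (inj₁; inj₂)
  open import Data.Product using (_,_)
  open import Data.List using ([]; _∷_; _++_; [_])
  open import Data.Rational as ℚ using (ℚ)
  open import Relation.Binary.PropositionalEquality hiding ([_])
  open Fractions
  open ClosedWalks using (pathSum; cycleSum)
  open ScaledInstance i j k

  D-1 : ℕ
  D-1 = ℕ.pred D

  1/[1+i]≡A/D : frac 1 i ≡ A ÷ D
  1/[1+i]≡A/D = ÷-cross-≡ 1 A i D-1 (lemma A (suc i))
    where
    lemma : ∀ a b → 1 * (b * a) ≡ a * b
    lemma = solve-∀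

  1/[1+j]≡B/D : frac 1 j ≡ B ÷ D
  1/[1+j]≡B/D = ÷-cross-≡ 1 B j D-1 (lemma i j k)
    where
    lemma : ∀ i j k → 1 * ((1 + i) * ((1 + j) * (1 + k))) ≡ (1 + i) * (1 + k) * (1 + j)
    lemma = solve-∀

  1/[1+k]≡C/D : frac 1 k ≡ C ÷ D
  1/[1+k]≡C/D = ÷-cross-≡ 1 C k D-1 (lemma i j k)
    where
    lemma : ∀ i j k → 1 * ((1 + i) * ((1 + j) * (1 + k))) ≡ (1 + i) * (1 + j) * (1 + k)
    lemma = solve-∀

  pos≡scaled : ∀ u → pos i j k u ≡ (x u ÷ D , y u ÷ D , z u ÷ D)
  pos≡scaled (inj₁ s) =
    cong₂ _,_ (sym (0÷ D-1)) (cong₂ _,_ (sym (0÷ D-1)) (÷-cross-≡ (toℕ s) (toℕ s * A) i D-1 (lemma (toℕ s) A (suc i))))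
    where
    lemma : ∀ t a b → t * (b * a) ≡ t * a * b
    lemma = solve-∀
  pos≡scaled (inj₂ (inj₁ s)) =
    cong₂ _,_ (trans (cong₂ ℚ._+_ 1/[1+i]≡A/D 1/[1+j]≡B/D) (÷-+-same A B D-1))
              (cong₂ _,_ (sym (0÷ D-1)) (÷-cross-≡ (toℕ s) (toℕ s * B) j D-1 (lemma (toℕ s) i j k)))
    where
    lemma : ∀ t i j k → t * ((1 + i) * ((1 + j) * (1 + k))) ≡ t * ((1 + i) * (1 + k)) * (1 + j)
    lemma = solve-∀
  pos≡scaled (inj₂ (inj₂ s)) =
    cong₂ _,_ 1/[1+i]≡A/D (cong₂ _,_ 1/[1+k]≡C/D (÷-cross-≡ (toℕ s) (toℕ s * C) k D-1 (lemma (toℕ s) i j k)))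
    where
    lemma : ∀ t i j k → t * ((1 + i) * ((1 + j) * (1 + k))) ≡ t * ((1 + i) * (1 + j)) * (1 + k)
    lemma = solve-∀

  cost≡dist/D : ∀ u w → cost i j k u w ≡ dist u w ÷ D
  cost≡dist/D u w = begin
    cost i j k u w                                                                          ≡⟨ cong₂ dist₁ (pos≡scaled u) (pos≡scaled w) ⟩
    ℚ.∣ x u ÷ D ℚ.- x w ÷ D ∣ ℚ.+ ℚ.∣ y u ÷ D ℚ.- y w ÷ D ∣ ℚ.+ ℚ.∣ z u ÷ D ℚ.- z w ÷ D ∣
      ≡⟨ cong₂ ℚ._+_ (cong₂ ℚ._+_ (∣÷-÷∣ (x u) (x w) D-1) (∣÷-÷∣ (y u) (y w) D-1)) (∣÷-÷∣ (z u) (z w) D-1) ⟩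
    ∣ x u - x w ∣ ÷ D ℚ.+ ∣ y u - y w ∣ ÷ D ℚ.+ ∣ z u - z w ∣ ÷ D
      ≡⟨ cong (ℚ._+ ∣ z u - z w ∣ ÷ D) (÷-+-same ∣ x u - x w ∣ ∣ y u - y w ∣ D-1) ⟩
    (∣ x u - x w ∣ + ∣ y u - y w ∣) ÷ D ℚ.+ ∣ z u - z w ∣ ÷ D                              ≡⟨ ÷-+-same (∣ x u - x w ∣ + ∣ y u - y w ∣) ∣ z u - z w ∣ D-1 ⟩
    dist u w ÷ D                                                                            ∎
    where open ≡-Reasoning

  pathLength≡ : ∀ u l → pathLength u l ≡ pathSum dist u l ÷ D
  pathLength≡ u []      = sym (0÷ D-1)
  pathLength≡ u (w ∷ l) = trans (cong₂ ℚ._+_ (cost≡dist/D u w) (pathLength≡ w l)) (÷-+-same (dist u w) (pathSum dist w l) D-1)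

  closedLength≡ : ∀ l → closedLength l ≡ cycleSum dist l ÷ D
  closedLength≡ []      = sym (0÷ D-1)
  closedLength≡ (v ∷ l) = pathLength≡ v (l ++ [ v ])

module LPCost (i j k : ℕ) where

  open import Data.Nat using (suc; _+_; _*_; ∣_-_∣)
  import Data.Nat.Properties as ℕP
  open import Data.Nat.Tactic.RingSolver using (solve-∀)
  open import Data.Fin using (Fin; toℕ; fromℕ; inject₁)
  import Data.Fin.Properties as FinP
  open import Data.Rational as ℚ using (ℚ)
  import Data.Rational.Properties as ℚP
  open import Relation.Binary.PropositionalEquality
  open Fractions
  open FinSums
  open VertexSums
  open ScaledInstance i j k
  open Support i j k using (X; Y; Z; support; along; ends; sum-*-support)
  open LPSolution i j k using (lpSolution; lpSolution-irrefl)
  open RationalScaling i j k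

  lpValue : ℕ
  lpValue = 3 * D + 2 * (A + B + C)

  dist-level : ∀ u w → z u ≡ z w → dist u w ≡ horizontalPart u w
  dist-level u w zu≡zw = begin
    dist u w                                ≡⟨ dist≡horizontal+vertical u w ⟩
    horizontalPart u w + ∣ z u - z w ∣      ≡⟨ cong (λ h → horizontalPart u w + ∣ h - z w ∣) zu≡zw ⟩
    horizontalPart u w + ∣ z w - z w ∣      ≡⟨ cong (horizontalPart u w +_) (ℕP.∣n-n∣≡0 (z w)) ⟩
    horizontalPart u w + 0                  ≡⟨ ℕP.+-identityʳ _ ⟩
    horizontalPart u w                      ∎
    where open ≡-Reasoning

  along-dist : ∀ {m} (L : Fin (suc (suc m)) → Vertex) h →
    (∀ s t → horizontalPart (L s) (L t) ≡ A * 0 + B * 0 + C * 0) → (∀ t → z (L t) ≡ toℕ t * h) →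
    along L dist ≡ suc m * (2 * h + 2 * h)
  along-dist {m} L h same-line height = trans (sumFin-cong (suc m) step) (sumFin-const (suc m) (2 * h + 2 * h))
    where
    no-horizontal : ∀ s t → dist (L s) (L t) ≡ ∣ z (L s) - z (L t) ∣
    no-horizontal s t = trans (dist≡horizontal+vertical (L s) (L t))
                              (trans (cong (_+ ∣ z (L s) - z (L t) ∣) (same-line s t)) (ar0 A B C _))
      where
      ar0 : ∀ a b c n → (a * 0 + b * 0 + c * 0) + n ≡ n
      ar0 = solve-∀
    up : ∀ s → ∣ z (L (inject₁ s)) - z (L (Fin.suc s)) ∣ ≡ h
    up s rewrite height (inject₁ s) | height (Fin.suc s) | FinP.toℕ-inject₁ s =
      trans (cong (λ n → ∣ toℕ s * h - n ∣) (ℕP.+-comm h (toℕ s * h))) (ℕP.∣m-m+n∣≡n (toℕ s * h) h)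
    down : ∀ s → ∣ z (L (Fin.suc s)) - z (L (inject₁ s)) ∣ ≡ h
    down s = trans (ℕP.∣-∣-comm (z (L (Fin.suc s))) (z (L (inject₁ s)))) (up s)
    step : ∀ s → 2 * dist (L (inject₁ s)) (L (Fin.suc s)) + 2 * dist (L (Fin.suc s)) (L (inject₁ s)) ≡ 2 * h + 2 * h
    step s = cong₂ (λ a b → 2 * a + 2 * b) (trans (no-horizontal _ _) (up s)) (trans (no-horizontal _ _) (down s))

  top-height : ∀ {m} (L : Fin (suc (suc m)) → Vertex) h → (∀ t → z (L t) ≡ toℕ t * h) → suc m * h ≡ D →
    z (L (fromℕ (suc m))) ≡ D
  top-height {m} L h height [1+m]*h≡D = trans (height _) (trans (cong (_* h) (FinP.toℕ-fromℕ (suc m))) [1+m]*h≡D)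

  ends-dist : ∀ {m m′} (P : Fin (suc (suc m)) → Vertex) (Q : Fin (suc (suc m′)) → Vertex) →
    z (P Fin.zero) ≡ z (Q Fin.zero) → z (P (fromℕ (suc m))) ≡ z (Q (fromℕ (suc m′))) →
    ends P Q dist ≡ horizontalPart (P Fin.zero) (Q Fin.zero) + horizontalPart (P (fromℕ (suc m))) (Q (fromℕ (suc m′)))
  ends-dist {m} {m′} P Q bottom top = cong₂ _+_ (dist-level (P Fin.zero) (Q Fin.zero) bottom) (dist-level (P (fromℕ (suc m))) (Q (fromℕ (suc m′))) top)

  weightedCost : sumV (λ u → sumV (λ w → dist u w * support u w)) ≡ 4 * lpValue
  weightedCost = begin
    sumV (λ u → sumV (λ w → dist u w * support u w))
      ≡⟨ sum-*-support dist ⟩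
    (along X dist + (ends X Y dist + ends X Z dist)) + ((ends Y X dist + (along Y dist + ends Y Z dist))
      + (ends Z X dist + (ends Z Y dist + along Z dist)))
      ≡⟨ cong₂ _+_ (cong₂ _+_ alongX (cong₂ _+_ (ends-dist X Y refl (trans topX (sym topY))) (ends-dist X Z refl (trans topX (sym topZ)))))
           (cong₂ _+_ (cong₂ _+_ (ends-dist Y X refl (trans topY (sym topX))) (cong₂ _+_ alongY (ends-dist Y Z refl (trans topY (sym topZ)))))
                      (cong₂ _+_ (ends-dist Z X refl (trans topZ (sym topX))) (cong₂ _+_ (ends-dist Z Y refl (trans topZ (sym topY))) alongZ))) ⟩
    (suc i * (2 * A + 2 * A) + ((XY + XY) + (XZ + XZ))) + (((XY + XY) + (suc j * (2 * B + 2 * B) + (YZ + YZ)))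
      + ((XZ + XZ) + ((YZ + YZ) + suc k * (2 * C + 2 * C))))
      ≡⟨ arithmetic i j k ⟩
    4 * lpValue ∎
    where
    open ≡-Reasoning
    XY XZ YZ : ℕ
    XY = A * 1 + B * 1 + C * 0
    XZ = A * 1 + B * 0 + C * 1
    YZ = A * 0 + B * 1 + C * 1
    alongX : along X dist ≡ suc i * (2 * A + 2 * A)
    alongX = along-dist X A (λ _ _ → refl) (λ _ → refl)
    alongY : along Y dist ≡ suc j * (2 * B + 2 * B)
    alongY = along-dist Y B (λ _ _ → refl) (λ _ → refl)
    alongZ : along Z dist ≡ suc k * (2 * C + 2 * C)
    alongZ = along-dist Z C (λ _ _ → refl) (λ _ → refl)
    topX : z (X (fromℕ (suc i))) ≡ D
    topX = top-height X A (λ _ → refl) refl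
    topY : z (Y (fromℕ (suc j))) ≡ D
    topY = top-height Y B (λ _ → refl) (sym D≡[1+j]*B)
    topZ : z (Z (fromℕ (suc k))) ≡ D
    topZ = top-height Z C (λ _ → refl) (sym D≡[1+k]*C)
    -- Each path has total length D, each triangle has perimeter 2(A + B + C); the factor 4 is 2 · 2.
    arithmetic : ∀ i j k → let A = (1 + j) * (1 + k) ; B = (1 + i) * (1 + k) ; C = (1 + i) * (1 + j) in
      ((1 + i) * (2 * A + 2 * A) + (((A * 1 + B * 1 + C * 0) + (A * 1 + B * 1 + C * 0)) + ((A * 1 + B * 0 + C * 1) + (A * 1 + B * 0 + C * 1))))
      + ((((A * 1 + B * 1 + C * 0) + (A * 1 + B * 1 + C * 0)) + ((1 + j) * (2 * B + 2 * B) + ((A * 0 + B * 1 + C * 1) + (A * 0 + B * 1 + C * 1))))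
        + (((A * 1 + B * 0 + C * 1) + (A * 1 + B * 0 + C * 1)) + (((A * 0 + B * 1 + C * 1) + (A * 0 + B * 1 + C * 1)) + (1 + k) * (2 * C + 2 * C))))
      ≡ 4 * (3 * ((1 + i) * A) + 2 * (A + B + C))
    arithmetic = solve-∀

  lpCost≡lpValue/D : lpCost lpSolution ≡ lpValue ÷ D
  lpCost≡lpValue/D = begin
    1 ÷ 2 ℚ.* sumℚ (λ u → sumOthers u (weighted u)) (allV i j k)
      ≡⟨ cong (1 ÷ 2 ℚ.*_) (trans (sumℚ-cong inner (allV i j k)) (sumℚ-÷ 2D-1 (λ u → sumList (λ v → dist u v * support u v) (allV i j k)) (allV i j k))) ⟩
    1 ÷ 2 ℚ.* sumList (λ u → sumList (λ v → dist u v * support u v) (allV i j k)) (allV i j k) ÷ suc 2D-1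
      ≡⟨ cong (λ n → 1 ÷ 2 ℚ.* n ÷ suc 2D-1) total ⟩
    1 ÷ 2 ℚ.* (4 * lpValue) ÷ suc 2D-1
      ≡⟨ ÷-* 1 (4 * lpValue) 1 2D-1 ⟩
    (1 * (4 * lpValue)) ÷ (2 * suc 2D-1)
      ≡⟨ ÷-cross-≡ (1 * (4 * lpValue)) lpValue (2D-1 + (suc 2D-1 + 0)) D-1 (cancel lpValue D-1) ⟩
    lpValue ÷ D ∎
    where
    open ≡-Reasoning
    2D-1 : ℕ
    2D-1 = 1 + D-1 * 2
    weighted : Vertex → Vertex → ℚ
    weighted u v = cost i j k u v ℚ.* lpSolution u v
    weighted≡ : ∀ u v → weighted u v ≡ (dist u v * support u v) ÷ suc 2D-1
    weighted≡ u v = trans (cong (ℚ._* lpSolution u v) (cost≡dist/D u v)) (÷-* (dist u v) (support u v) D-1 1)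
    inner : ∀ u → sumOthers u (weighted u) ≡ sumList (λ v → dist u v * support u v) (allV i j k) ÷ suc 2D-1
    inner u = trans (sumOthers≡sumℚ u (weighted u) (trans (cong (cost i j k u u ℚ.*_) (lpSolution-irrefl u)) (ℚP.*-zeroʳ (cost i j k u u))))
                    (trans (sumℚ-cong (weighted≡ u) (allV i j k)) (sumℚ-÷ 2D-1 (λ v → dist u v * support u v) (allV i j k)))
    total : sumList (λ u → sumList (λ v → dist u v * support u v) (allV i j k)) (allV i j k) ≡ 4 * lpValue
    total = trans (sumList-cong (λ u → sumList-allV (λ v → dist u v * support u v)) (allV i j k))
                  (trans (sumList-allV (λ u → sumV (λ v → dist u v * support u v))) weightedCost)
    cancel : ∀ q d → (1 * (4 * q)) * suc d ≡ q * (2 * (suc d * 2))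
    cancel = solve-∀

  qBound≡lpValue/D : qBound i j k ≡ lpValue ÷ D
  qBound≡lpValue/D = begin
    3 ÷ 1 ℚ.+ 2 ÷ 1 ℚ.* (frac 1 i ℚ.+ frac 1 j ℚ.+ frac 1 k)
      ≡⟨ cong (λ q → 3 ÷ 1 ℚ.+ 2 ÷ 1 ℚ.* q) (trans (cong₂ ℚ._+_ (trans (cong₂ ℚ._+_ 1/[1+i]≡A/D 1/[1+j]≡B/D) (÷-+-same A B D-1)) 1/[1+k]≡C/D)
                                                  (÷-+-same (A + B) C D-1)) ⟩
    3 ÷ 1 ℚ.+ 2 ÷ 1 ℚ.* (A + B + C) ÷ D
      ≡⟨ cong (3 ÷ 1 ℚ.+_) (÷-* 2 (A + B + C) 0 D-1) ⟩
    3 ÷ 1 ℚ.+ (2 * (A + B + C)) ÷ (1 * D)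
      ≡⟨ ÷-+ 3 (2 * (A + B + C)) 0 (D-1 + 0) ⟩
    (3 * suc (D-1 + 0) + 2 * (A + B + C) * 1) ÷ (1 * suc (D-1 + 0))
      ≡⟨ ÷-cross-≡ (3 * suc (D-1 + 0) + 2 * (A + B + C) * 1) lpValue ((D-1 + 0) + 0) D-1 (normalise A B C D-1) ⟩
    lpValue ÷ D ∎
    where
    open ≡-Reasoning
    normalise : ∀ a b c d → (3 * suc (d + 0) + 2 * (a + b + c) * 1) * suc d ≡ (3 * suc d + 2 * (a + b + c)) * (1 * suc (d + 0))
    normalise = solve-∀

module IntegralityRatio (i j k : ℕ) where

  open import Data.Nat using (suc; _+_; _*_; _≤_)
  import Data.Nat.Properties as ℕP
  open import Data.Nat.Tactic.RingSolver using (solve-∀)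
  open import Data.Rational as ℚ using (ℚ; 1ℚ)
  open import Relation.Binary.PropositionalEquality
  open Fractions
  open ClosedWalks using (cycleSum)
  open ScaledInstance i j k
  open RationalScaling i j k
  open LPSolution i j k using (lpSolution)
  open LPCost i j k

  lpValue+D≤tour : (H : Tour i j k) → lpValue + D ≤ cycleSum dist (Tour.order H)
  lpValue+D≤tour H = subst (_≤ cycleSum dist (Tour.order H)) (regroup D A B C) (TourBound.tourLength-≥ i j k H)
    where
    regroup : ∀ d a b c → d * 4 + 2 * (a + b + c) ≡ 3 * d + 2 * (a + b + c) + d
    regroup = solve-∀

  ratio-bound : (H : Tour i j k) → (qBound i j k ℚ.+ 1ℚ) ℚ.* lpCost lpSolution ℚ.≤ qBound i j k ℚ.* tourLength H
  ratio-bound H = subst₂ ℚ._≤_ (sym lhs) (sym rhs) (÷-monoˡ-≤ (D-1 + D-1 * suc D-1) scaled)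
    where
    T : ℕ
    T = cycleSum dist (Tour.order H)
    scaled : (lpValue + D) * lpValue ≤ lpValue * T
    scaled = ℕP.≤-trans (ℕP.*-monoˡ-≤ lpValue (lpValue+D≤tour H)) (ℕP.≤-reflexive (ℕP.*-comm T lpValue))
    1ℚ≡D/D : 1ℚ ≡ D ÷ D
    1ℚ≡D/D = ÷-cross-≡ 1 D 0 D-1 (trans (ℕP.*-identityˡ D) (sym (ℕP.*-identityʳ D)))
    lhs : (qBound i j k ℚ.+ 1ℚ) ℚ.* lpCost lpSolution ≡ ((lpValue + D) * lpValue) ÷ (D * D)
    lhs = trans (cong₂ ℚ._*_ (trans (cong₂ ℚ._+_ qBound≡lpValue/D 1ℚ≡D/D) (÷-+-same lpValue D D-1)) lpCost≡lpValue/D)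
                (÷-* (lpValue + D) lpValue D-1 D-1)
    rhs : qBound i j k ℚ.* tourLength H ≡ (lpValue * T) ÷ (D * D)
    rhs = trans (cong₂ ℚ._*_ qBound≡lpValue/D (closedLength≡ (Tour.order H))) (÷-* lpValue T D-1 D-1)

open import Data.Rational using (ℚ; _≤_; _*_; _+_; 1ℚ)

mainTheorem10 : (i j k : ℕ) →
    Σ (V i j k → V i j k → ℚ) λ x →
    SubtourFeasible i j k x ×
    ((H : Tour i j k) → (qBound i j k + 1ℚ) * lpCost x ≤ qBound i j k * tourLength H)
mainTheorem10 i j k = lpSolution , lpSolution-feasible , ratio-bound
  where
  open LPSolution i j k using (lpSolution; lpSolution-feasible)
  open IntegralityRatio i j k using (ratio-bound)
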